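{- Let $P=\{010,210\}$. Let $\mathfrak a_{n,m,f}$ be the number of $\sigma\in\mathcal{I}_n(010,210)$ with $\max(\sigma)=m$ and $|\mathbf{Forb}(\sigma,P)|=f$. For $k>0$, let $\mathfrak b_{n,k}$ be the number of words $\omega$ of length $n$ over $\{0,\dots,k\}$ avoiding $010$, such that $\omega_i<\omega_j<k$ implies $i<j$, and such that the letter $k-1$ appears in $\omega$; let $\mathfrak b_{n,0}=1$. Then for all integers $2\leqslant f\leqslant m+1\leqslant n$, $$\mathfrak a_{n,m,f}=\sum_{p=m+1}^{n}\sum_{i=0}^{f-1}\mathfrak b_{n-p,f-i-1}\sum_{j=0}^{m-1}\mathfrak a_{p-1,j,i}.$$
   Context: For $n\in\mathbb N$, an inversion sequence of size $n$ is a sequence $\sigma=(\sigma_1,\dots,\sigma_n)\in\mathbb N^n$ with $\sigma_i<i$ for all $i$. An integer sequence contains a pattern $\rho$ (a finite integer sequence such as $010$ or $210$) if it has a subsequence order-isomorphic to $\rho$, and avoids $\rho$ otherwise. $\mathcal{I}_n(P)$ denotes the set of inversion sequences of size $n$ avoiding every pattern in $P$. $\max(\sigma)$ is the largest entry of $\sigma$ ($-1$ for the empty sequence). For an integer sequence $\alpha$ avoiding the patterns in a set $P$, a value $v\in\{0,\dots,\max(\alpha)\}$ is forbidden by $\alpha$ and $P$ if the sequence $\alpha\cdot(M,v)$ (i.e. $\alpha$ followed by an entry $M$ and then an entry $v$) contains a pattern of $P$ whenever $M>\max(\alpha)$; $\mathbf{Forb}(\alpha,P)$ is the set of such forbidden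 values. -}

module Defs where

open import Data.Bool using (Bool; true; false; _∧_; _∨_; not; if_then_else_)
open import Data.Nat using (ℕ; zero; suc; _+_; _*_; _∸_; _⊔_; _<ᵇ_; _≡ᵇ_)
open import Data.List using (List; []; _∷_; _++_; length; map; upTo; concatMap; filter; zip; foldr)
open import Data.Bool.ListAction using (all; any)
open import Data.Nat.ListAction using (sum)
open import Data.Product using (_×_; _,_)
open import Function using (_∘_)
open import Relation.Binary.PropositionalEquality using (_≡_)

_==ᵇ_ : Bool → Bool → Bool
true  ==ᵇ b = b
false ==ᵇ b = not b

words : ℕ → ℕ → List (List ℕ)
words k zero    = [] ∷ []
words k (suc n) = concatMap (λ x → map (x ∷_) (words k n)) (upTo (suc k))

-- σ = (σ₁,…,σₙ) is an inversion sequence: σᵢ < i  (positions 1-indexed)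
isInvFrom : ℕ → List ℕ → Bool
isInvFrom i []       = true
isInvFrom i (x ∷ xs) = (x <ᵇ i) ∧ isInvFrom (suc i) xs

isInvSeq : List ℕ → Bool
isInvSeq = isInvFrom 1

-- all inversion sequences of size n (every entry is < n, so they are among the words over {0,…,n})
invSeqs : ℕ → List (List ℕ)
invSeqs n = filter (λ σ → isInvSeq σ Data.Bool.≟ true) (words n n)
  where import Data.Bool

subseqs : List ℕ → List (List ℕ)
subseqs []       = [] ∷ []
subseqs (x ∷ xs) = let r = subseqs xs in map (x ∷_) r ++ r

orderIso : List ℕ → List ℕ → Bool
orderIso a b = (length a ≡ᵇ length b) ∧
  all (λ { (x , y) → all (λ { (x' , y') →
        ((x <ᵇ x') ==ᵇ (y <ᵇ y')) ∧ ((x ≡ᵇ x') ==ᵇ (y ≡ᵇ y')) }) zs }) zs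
  where zs = zip a b

contains : List ℕ → List ℕ → Bool
contains ρ s = any (λ t → orderIso t ρ) (subseqs s)

containsSome : List (List ℕ) → List ℕ → Bool
containsSome P s = any (λ ρ → contains ρ s) P

avoidsAll : List (List ℕ) → List ℕ → Bool
avoidsAll P s = not (containsSome P s)

p010 p210 : List ℕ
p010 = 0 ∷ 1 ∷ 0 ∷ []
p210 = 2 ∷ 1 ∷ 0 ∷ []

P : List (List ℕ)
P = p010 ∷ p210 ∷ []

-- max(σ) = m  (the empty sequence has max −1, so it has no max in ℕ)
maxIs : List ℕ → ℕ → Bool
maxIs []       m = false
maxIs (x ∷ xs) m = foldr _⊔_ x xs ≡ᵇ m

-- max of a nonempty sequence (only used when α is nonempty)
maxℕ : List ℕ → ℕ
maxℕ []       = 0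
maxℕ (x ∷ xs) = foldr _⊔_ x xs

-- v is forbidden by α and P.  The condition "α·(M,v) contains a pattern of P for M > max α"
-- depends only on the relative order of entries, hence is tested with M = max(α)+1.
forbidden : List (List ℕ) → List ℕ → ℕ → Bool
forbidden Q α v = containsSome Q (α ++ suc (maxℕ α) ∷ v ∷ [])

forbCount : List (List ℕ) → List ℕ → ℕ
forbCount Q []        = 0
forbCount Q α@(_ ∷ _) = length (filter (λ v → forbidden Q α v Data.Bool.≟ true) (upTo (suc (maxℕ α))))
  where import Data.Bool

countB : {A : Set} → (A → Bool) → List A → ℕ
countB p xs = length (filter (λ x → p x Data.Bool.≟ true) xs)
  where import Data.Bool

𝔞 : ℕ → ℕ → ℕ → ℕ
𝔞 n m f = countB (λ σ → avoidsAll P σ ∧ maxIs σ m ∧ (forbCount P σ ≡ᵇ f)) (invSeqs n)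

-- condition: ω_i < ω_j < k implies i < j
-- (equivalently: no position j with a later-or-equal position i having ω_i < ω_j < k)
orderedBelow : ℕ → List ℕ → Bool
orderedBelow k []       = true
orderedBelow k (x ∷ xs) = all (λ y → not ((y <ᵇ x) ∧ (x <ᵇ k))) xs ∧ orderedBelow k xs

𝔟 : ℕ → ℕ → ℕ
𝔟 n zero    = 1
𝔟 n (suc k') = countB (λ ω → avoidsAll (p010 ∷ []) ω ∧ orderedBelow (suc k') ω ∧ any (_≡ᵇ k') ω)
                      (words (suc k') n)

-- Σ_{i=a}^{b} g i   (empty when b < a)
sumFromTo : ℕ → ℕ → (ℕ → ℕ) → ℕ
sumFromTo a b g = sum (map (λ t → g (a + t)) (upTo (suc b ∸ a)))

-- Cut σ ∈ I_n(010,210) with max σ = m at the first occurrence of m, at position p: σ = α · m · ω.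
-- The prefix α is an inversion sequence of size p − 1 avoiding 010 and 210 with max α = j < m; let
-- i = |Forb(α,P)|.  As m exceeds α, σ avoids both patterns iff the letters v < m of ω are not forbidden
-- by α and weakly increase, strictly across each occurrence of m.  The forbidden values of σ are then
-- those of α, the value m, and the values not forbidden by α up to the last letter c < m of ω; so
-- |Forb(σ,P)| = f says that c has rank k = f − i − 1 among the values not forbidden by α.  Relabelling
-- these values by their ranks, and m by k, maps the admissible tails ω onto the words counted by
-- 𝔟(n − p, k).  All counts are sums of Iverson brackets over words, and the tails are read by an
-- automaton remembering only c.

module Submission where

open import Defs
open import Algebra.Bundles using (CommutativeMonoid)
open import Data.Bool using (Bool; true; false; _∧_; _∨_; not; T; if_then_else_)
open import Data.Bool.Properties
  using (T-≡; ¬-not; not-¬; not-involutive; ∨-commutativeMonoid; ∨-identityʳ; ∨-assoc; ∨-zeroʳ; ∧-identityʳ; ∧-zeroʳ; ∧-comm; ∧-assoc)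
open import Data.Bool.ListAction using (all; any)
open import Data.Empty using (⊥; ⊥-elim)
open import Data.List using (List; []; _∷_; _++_; length; map; upTo; applyUpTo; concat; filter; zip)
open import Data.List.Membership.Propositional using (_∈_)
open import Data.List.Properties using (++-assoc; ++-identityʳ; map-∘; map-cong; map-++)
open import Data.List.Relation.Unary.All using (All; []; _∷_)
import Data.List.Relation.Unary.All as All
open import Data.List.Relation.Unary.All.Properties using (all⁺; ++⁺)
open import Data.List.Relation.Unary.Any using (here; there)
open import Data.Nat using (ℕ; zero; suc; _+_; _*_; _∸_; _≤_; _<_; _≡ᵇ_; _<ᵇ_; z≤n; s≤s; z<s; s<s)
open import Data.Nat.ListAction using (sum)
open import Data.Nat.ListAction.Properties using (sum-++)
open import Data.Nat.Properties
open import Data.Nat.Tactic.RingSolver using (solve-∀)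
open import Data.Product using (_×_; _,_; proj₁; proj₂; ∃)
open import Data.Sum using (_⊎_; inj₁; inj₂)
open import Data.Unit using (⊤)
open import Function using (_∘_; Equivalence)
open import Relation.Binary.Definitions using (tri<; tri≈; tri>)
open import Relation.Binary.PropositionalEquality
open import Relation.Nullary using (yes; no)
open import Algebra.Properties.CommutativeSemigroup +-commutativeSemigroup
  using () renaming (interchange to +-interchange)
open import Algebra.Properties.CommutativeSemigroup (CommutativeMonoid.commutativeSemigroup ∨-commutativeMonoid)
  using () renaming (interchange to ∨-interchange)
open ≡-Reasoning

<⇒<ᵇ≡true : ∀ {m n} → m < n → (m <ᵇ n) ≡ true
<⇒<ᵇ≡true m<n = Equivalence.to T-≡ (<⇒<ᵇ m<n)

≥⇒<ᵇ≡false : ∀ {m n} → n ≤ m → (m <ᵇ n) ≡ false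
≥⇒<ᵇ≡false n≤m = ¬-not (λ m<ᵇn → ≤⇒≯ n≤m (<ᵇ⇒< _ _ (Equivalence.from T-≡ m<ᵇn)))

<ᵇ≡true⇒< : ∀ {m n} → (m <ᵇ n) ≡ true → m < n
<ᵇ≡true⇒< e = <ᵇ⇒< _ _ (Equivalence.from T-≡ e)

<ᵇ-irrefl : ∀ n → (n <ᵇ n) ≡ false
<ᵇ-irrefl n = ≥⇒<ᵇ≡false {n} {n} ≤-refl

≡ᵇ-refl : ∀ n → (n ≡ᵇ n) ≡ true
≡ᵇ-refl n = Equivalence.to T-≡ (≡⇒≡ᵇ n n refl)

≡⇒≡ᵇ≡true : ∀ {m n} → m ≡ n → (m ≡ᵇ n) ≡ true
≡⇒≡ᵇ≡true {m} refl = ≡ᵇ-refl m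

≡ᵇ≡true⇒≡ : ∀ {m n} → (m ≡ᵇ n) ≡ true → m ≡ n
≡ᵇ≡true⇒≡ e = ≡ᵇ⇒≡ _ _ (Equivalence.from T-≡ e)

≡ᵇ-sym : ∀ m n → (m ≡ᵇ n) ≡ (n ≡ᵇ m)
≡ᵇ-sym zero    zero    = refl
≡ᵇ-sym zero    (suc n) = refl
≡ᵇ-sym (suc m) zero    = refl
≡ᵇ-sym (suc m) (suc n) = ≡ᵇ-sym m n

≢⇒≡ᵇ≡false : ∀ {m n} → m ≢ n → (m ≡ᵇ n) ≡ false
≢⇒≡ᵇ≡false m≢n = ¬-not (λ e → m≢n (≡ᵇ≡true⇒≡ e))

∧-trueˡ : ∀ {a b} → a ∧ b ≡ true → a ≡ true
∧-trueˡ {true} _ = refl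

∧-trueʳ : ∀ {a b} → a ∧ b ≡ true → b ≡ true
∧-trueʳ {true} e = e

∧-true : ∀ {a b} → a ≡ true → b ≡ true → a ∧ b ≡ true
∧-true refl refl = refl

∨-true⁻ : ∀ {a b} → a ∨ b ≡ true → a ≡ true ⊎ b ≡ true
∨-true⁻ {true}  e = inj₁ refl
∨-true⁻ {false} e = inj₂ e

∨-trueˡ : ∀ {a b} → a ≡ true → a ∨ b ≡ true
∨-trueˡ refl = refl

∨-trueʳ : ∀ {a b} → b ≡ true → a ∨ b ≡ true
∨-trueʳ {true}  e = refl
∨-trueʳ {false} e = e

not-∨ : ∀ a b → not (a ∨ b) ≡ not a ∧ not b
not-∨ true  b = refl
not-∨ false b = refl

true-ext : ∀ {a b : Bool} → (a ≡ true → b ≡ true) → (b ≡ true → a ≡ true) → a ≡ b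
true-ext {true}  {true}  f g = refl
true-ext {true}  {false} f g = sym (f refl)
true-ext {false} {true}  f g = g refl
true-ext {false} {false} f g = refl

⟦_⟧ : Bool → ℕ
⟦ true  ⟧ = 1
⟦ false ⟧ = 0

⟦∧⟧ : ∀ a b → ⟦ a ∧ b ⟧ ≡ ⟦ a ⟧ * ⟦ b ⟧
⟦∧⟧ true  b = sym (+-identityʳ ⟦ b ⟧)
⟦∧⟧ false b = refl

⟦∨⟧ : ∀ a b → ⟦ a ∨ b ⟧ ≡ ⟦ a ⟧ + ⟦ not a ⟧ * ⟦ b ⟧
⟦∨⟧ true  b = refl
⟦∨⟧ false b = sym (+-identityʳ ⟦ b ⟧)

⟦⟧+⟦not⟧ : ∀ b → ⟦ b ⟧ + ⟦ not b ⟧ ≡ 1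
⟦⟧+⟦not⟧ true  = refl
⟦⟧+⟦not⟧ false = refl

∑< : (ℕ → ℕ) → ℕ → ℕ
∑< g zero    = 0
∑< g (suc n) = g 0 + ∑< (g ∘ suc) n

∑<-cong : ∀ {g h} n → (∀ x → x < n → g x ≡ h x) → ∑< g n ≡ ∑< h n
∑<-cong zero    e = refl
∑<-cong (suc n) e = cong₂ _+_ (e 0 z<s) (∑<-cong n (λ x x<n → e (suc x) (s<s x<n)))

∑<-≡0 : ∀ {g} n → (∀ x → x < n → g x ≡ 0) → ∑< g n ≡ 0
∑<-≡0 zero    e = refl
∑<-≡0 (suc n) e rewrite e 0 z<s = ∑<-≡0 n (λ x x<n → e (suc x) (s<s x<n))

∑<-+ : ∀ g h n → ∑< (λ x → g x + h x) n ≡ ∑< g n + ∑< h n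
∑<-+ g h zero    = refl
∑<-+ g h (suc n) = trans (cong (g 0 + h 0 +_) (∑<-+ (g ∘ suc) (h ∘ suc) n)) (+-interchange (g 0) (h 0) _ _)

∑<-*ˡ : ∀ c g n → ∑< (λ x → c * g x) n ≡ c * ∑< g n
∑<-*ˡ c g zero    = sym (*-zeroʳ c)
∑<-*ˡ c g (suc n) = trans (cong (c * g 0 +_) (∑<-*ˡ c (g ∘ suc) n)) (sym (*-distribˡ-+ c (g 0) _))

∑<-comm : ∀ (g : ℕ → ℕ → ℕ) a b → ∑< (λ x → ∑< (g x) b) a ≡ ∑< (λ y → ∑< (λ x → g x y) a) b
∑<-comm g zero    b = sym (∑<-≡0 b (λ _ _ → refl))
∑<-comm g (suc a) b = trans (cong (∑< (g 0) b +_) (∑<-comm (g ∘ suc) a b)) (sym (∑<-+ (g 0) _ b))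

∑<-split : ∀ g a b → ∑< g (a + b) ≡ ∑< g a + ∑< (λ x → g (a + x)) b
∑<-split g zero    b = refl
∑<-split g (suc a) b = trans (cong (g 0 +_) (∑<-split (g ∘ suc) a b)) (sym (+-assoc (g 0) _ _))

∑<-last : ∀ g n → ∑< g (suc n) ≡ ∑< g n + g n
∑<-last g n = begin
  ∑< g (suc n)                        ≡⟨ cong (∑< g) (+-comm 1 n) ⟩
  ∑< g (n + 1)                        ≡⟨ ∑<-split g n 1 ⟩
  ∑< g n + (g (n + 0) + 0)            ≡⟨ cong (λ z → ∑< g n + z) (trans (+-identityʳ _) (cong g (+-identityʳ n))) ⟩
  ∑< g n + g n                        ∎

∑<-shrink : ∀ g {a b} → a ≤ b → (∀ x → a ≤ x → x < b → g x ≡ 0) → ∑< g b ≡ ∑< g a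
∑<-shrink g {a} {b} a≤b e = begin
  ∑< g b                              ≡⟨ cong (∑< g) (sym (m+[n∸m]≡n a≤b)) ⟩
  ∑< g (a + (b ∸ a))                  ≡⟨ ∑<-split g a (b ∸ a) ⟩
  ∑< g a + ∑< (λ x → g (a + x)) (b ∸ a) ≡⟨ cong (∑< g a +_) (∑<-≡0 (b ∸ a) tail≡0) ⟩
  ∑< g a + 0                          ≡⟨ +-identityʳ _ ⟩
  ∑< g a                              ∎
  where
  tail≡0 : ∀ x → x < b ∸ a → g (a + x) ≡ 0
  tail≡0 x x<b∸a = e (a + x) (m≤m+n a x) (subst (a + x <_) (m+[n∸m]≡n a≤b) (+-monoʳ-< a x<b∸a))

∑<-mono : ∀ g {a b} → a ≤ b → ∑< g a ≤ ∑< g b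
∑<-mono g {a} {b} a≤b =
  subst (∑< g a ≤_) (trans (sym (∑<-split g a (b ∸ a))) (cong (∑< g) (m+[n∸m]≡n a≤b))) (m≤m+n (∑< g a) _)

∑<-restrict : ∀ g s n → s ≤ n → ∑< (λ x → ⟦ x <ᵇ s ⟧ * g x) n ≡ ∑< g s
∑<-restrict g zero    n       _         = ∑<-≡0 n (λ _ _ → refl)
∑<-restrict g (suc s) (suc n) (s≤s s≤n) = cong₂ _+_ (+-identityʳ (g 0)) (∑<-restrict (g ∘ suc) s n s≤n)

∑<-pick : ∀ g a n → ∑< (λ x → ⟦ x ≡ᵇ a ⟧ * g x) n ≡ ⟦ a <ᵇ n ⟧ * g a
∑<-pick g zero    zero    = refl
∑<-pick g (suc a) zero    = refl
∑<-pick g zero    (suc n) = trans (cong (g 0 + 0 +_) (∑<-≡0 n (λ _ _ → refl))) (+-identityʳ _)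
∑<-pick g (suc a) (suc n) = ∑<-pick (g ∘ suc) a n

∑<-ones : ∀ n → ∑< (λ _ → 1) n ≡ n
∑<-ones zero    = refl
∑<-ones (suc n) = cong suc (∑<-ones n)

∑<-complement : ∀ (b : ℕ → Bool) n → ∑< (λ v → ⟦ b v ⟧) n + ∑< (λ v → ⟦ not (b v) ⟧) n ≡ n
∑<-complement b n = begin
  ∑< (λ v → ⟦ b v ⟧) n + ∑< (λ v → ⟦ not (b v) ⟧) n ≡⟨ ∑<-+ _ _ n ⟨
  ∑< (λ v → ⟦ b v ⟧ + ⟦ not (b v) ⟧) n             ≡⟨ ∑<-cong n (λ v _ → ⟦⟧+⟦not⟧ (b v)) ⟩
  ∑< (λ _ → 1) n                                   ≡⟨ ∑<-ones n ⟩
  n                                                ∎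

sum-applyUpTo : ∀ (g f : ℕ → ℕ) n → sum (map g (applyUpTo f n)) ≡ ∑< (g ∘ f) n
sum-applyUpTo g f zero    = refl
sum-applyUpTo g f (suc n) = cong (g (f 0) +_) (sum-applyUpTo g (f ∘ suc) n)

sumFromTo≡∑< : ∀ a b g → sumFromTo a b g ≡ ∑< (λ t → g (a + t)) (suc b ∸ a)
sumFromTo≡∑< a b g = sum-applyUpTo (λ t → g (a + t)) (λ x → x) (suc b ∸ a)

sumFromTo-from0 : ∀ k g → 1 ≤ k → sumFromTo 0 (k ∸ 1) g ≡ ∑< g k
sumFromTo-from0 k g 1≤k = trans (sumFromTo≡∑< 0 (k ∸ 1) g) (cong (∑< g) (m+[n∸m]≡n 1≤k))

sumFromTo-suc : ∀ a b g → sumFromTo (suc a) b g ≡ ∑< (λ t → g (suc (a + t))) (b ∸ a)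
sumFromTo-suc a b g = sumFromTo≡∑< (suc a) b g

_∈ᵇ_ : ℕ → List ℕ → Bool
v ∈ᵇ w = any (_≡ᵇ v) w

_∉ᵇ_ : ℕ → List ℕ → Bool
v ∉ᵇ w = all (λ x → not (x ≡ᵇ v)) w

countB≡sum : ∀ {A : Set} (p : A → Bool) xs → countB p xs ≡ sum (map (⟦_⟧ ∘ p) xs)
countB≡sum p []       = refl
countB≡sum p (x ∷ xs) with p x
... | true  = cong suc (countB≡sum p xs)
... | false = countB≡sum p xs

countB-filter : ∀ {A : Set} (p q : A → Bool) xs →
  countB q (filter (λ x → p x Data.Bool.≟ true) xs) ≡ sum (map (λ x → ⟦ p x ∧ q x ⟧) xs)
countB-filter p q []       = refl
countB-filter p q (x ∷ xs) with p x
... | true  = trans (countB≡sum q (x ∷ filtered)) (cong (⟦ q x ⟧ +_) (trans (sym (countB≡sum q filtered)) (countB-filter p q xs)))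
  where filtered = filter (λ x → p x Data.Bool.≟ true) xs
... | false = countB-filter p q xs

sum-map-concat : ∀ {A : Set} (g : A → ℕ) xss → sum (map g (concat xss)) ≡ sum (map (sum ∘ map g) xss)
sum-map-concat g []         = refl
sum-map-concat g (xs ∷ xss) = begin
  sum (map g (xs ++ concat xss))            ≡⟨ cong sum (map-++ g xs (concat xss)) ⟩
  sum (map g xs ++ map g (concat xss))      ≡⟨ sum-++ (map g xs) _ ⟩
  sum (map g xs) + sum (map g (concat xss)) ≡⟨ cong (sum (map g xs) +_) (sum-map-concat g xss) ⟩
  sum (map (sum ∘ map g) (xs ∷ xss))        ∎

∑W : ℕ → ℕ → (List ℕ → ℕ) → ℕ
∑W k zero    g = g []
∑W k (suc n) g = ∑< (λ x → ∑W k n (λ w → g (x ∷ w))) (suc k)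

sum-map-words : ∀ k n g → sum (map g (words k n)) ≡ ∑W k n g
sum-map-words k zero    g = +-identityʳ _
sum-map-words k (suc n) g = begin
  sum (map g (concat (map (λ x → map (x ∷_) (words k n)) (upTo (suc k)))))
    ≡⟨ sum-map-concat g (map (λ x → map (x ∷_) (words k n)) (upTo (suc k))) ⟩
  sum (map (sum ∘ map g) (map (λ x → map (x ∷_) (words k n)) (upTo (suc k))))
    ≡⟨ cong sum (map-∘ (upTo (suc k))) ⟨
  sum (map (λ x → sum (map g (map (x ∷_) (words k n)))) (upTo (suc k)))
    ≡⟨ cong sum (map-cong (λ x → trans (cong sum (sym (map-∘ (words k n)))) (sum-map-words k n (g ∘ (x ∷_)))) (upTo (suc k))) ⟩
  sum (map (λ x → ∑W k n (g ∘ (x ∷_))) (upTo (suc k)))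
    ≡⟨ sum-applyUpTo _ (λ x → x) (suc k) ⟩
  ∑W k (suc n) g ∎

∑W-cong : ∀ k n {g h : List ℕ → ℕ} → (∀ w → All (_≤ k) w → length w ≡ n → g w ≡ h w) → ∑W k n g ≡ ∑W k n h
∑W-cong k zero    e = e [] [] refl
∑W-cong k (suc n) e = ∑<-cong (suc k) (λ x x≤k → ∑W-cong k n (λ w w≤k |w| → e (x ∷ w) (≤-pred x≤k ∷ w≤k) (cong suc |w|)))

∑W-≡0 : ∀ k n {g : List ℕ → ℕ} → (∀ w → All (_≤ k) w → length w ≡ n → g w ≡ 0) → ∑W k n g ≡ 0
∑W-≡0 k zero    e = e [] [] refl
∑W-≡0 k (suc n) e = ∑<-≡0 (suc k) (λ x x≤k → ∑W-≡0 k n (λ w w≤k |w| → e (x ∷ w) (≤-pred x≤k ∷ w≤k) (cong suc |w|)))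

∑W-+ : ∀ k n (g h : List ℕ → ℕ) → ∑W k n (λ w → g w + h w) ≡ ∑W k n g + ∑W k n h
∑W-+ k zero    g h = refl
∑W-+ k (suc n) g h =
  trans (∑<-cong (suc k) (λ x _ → ∑W-+ k n (g ∘ (x ∷_)) (h ∘ (x ∷_))))
        (∑<-+ (λ x → ∑W k n (g ∘ (x ∷_))) (λ x → ∑W k n (h ∘ (x ∷_))) (suc k))

∑W-*ˡ : ∀ k n c (g : List ℕ → ℕ) → ∑W k n (λ w → c * g w) ≡ c * ∑W k n g
∑W-*ˡ k zero    c g = refl
∑W-*ˡ k (suc n) c g = trans (∑<-cong (suc k) (λ x _ → ∑W-*ˡ k n c (g ∘ (x ∷_)))) (∑<-*ˡ c (λ x → ∑W k n (g ∘ (x ∷_))) (suc k))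

∑W-∑< : ∀ k n (g : ℕ → List ℕ → ℕ) a → ∑W k n (λ w → ∑< (λ i → g i w) a) ≡ ∑< (λ i → ∑W k n (g i)) a
∑W-∑< k zero    g a = refl
∑W-∑< k (suc n) g a = begin
  ∑< (λ x → ∑W k n (λ w → ∑< (λ i → g i (x ∷ w)) a)) (suc k) ≡⟨ ∑<-cong (suc k) (λ x _ → ∑W-∑< k n (λ i w → g i (x ∷ w)) a) ⟩
  ∑< (λ x → ∑< (λ i → ∑W k n (λ w → g i (x ∷ w))) a) (suc k) ≡⟨ ∑<-comm (λ x i → ∑W k n (λ w → g i (x ∷ w))) (suc k) a ⟩
  ∑< (λ i → ∑W k (suc n) (g i)) a                             ∎

-- the sum of g over the words w₁ ⋯ wₙ with wᵢ < s + i - 1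
∑Inv : ℕ → ℕ → (List ℕ → ℕ) → ℕ
∑Inv s zero    g = g []
∑Inv s (suc n) g = ∑< (λ x → ∑Inv (suc s) n (λ w → g (x ∷ w))) s

∑W-isInvFrom : ∀ k s n (g : List ℕ → ℕ) → s + n ≤ suc k → ∑W k n (λ w → ⟦ isInvFrom s w ⟧ * g w) ≡ ∑Inv s n g
∑W-isInvFrom k s zero    g _     = +-identityʳ (g [])
∑W-isInvFrom k s (suc n) g s+n≤k = begin
  ∑< (λ x → ∑W k n (λ w → ⟦ (x <ᵇ s) ∧ isInvFrom (suc s) w ⟧ * g (x ∷ w))) (suc k)
    ≡⟨ ∑<-cong (suc k) (λ x _ → factor x) ⟩
  ∑< (λ x → ⟦ x <ᵇ s ⟧ * ∑W k n (λ w → ⟦ isInvFrom (suc s) w ⟧ * g (x ∷ w))) (suc k)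
    ≡⟨ ∑<-restrict _ s (suc k) (≤-trans (m≤m+n s (suc n)) s+n≤k) ⟩
  ∑< (λ x → ∑W k n (λ w → ⟦ isInvFrom (suc s) w ⟧ * g (x ∷ w))) s
    ≡⟨ ∑<-cong s (λ x _ → ∑W-isInvFrom k (suc s) n (g ∘ (x ∷_)) (subst (_≤ suc k) (+-suc s n) s+n≤k)) ⟩
  ∑Inv s (suc n) g ∎
  where
  factor : ∀ x → ∑W k n (λ w → ⟦ (x <ᵇ s) ∧ isInvFrom (suc s) w ⟧ * g (x ∷ w)) ≡
                 ⟦ x <ᵇ s ⟧ * ∑W k n (λ w → ⟦ isInvFrom (suc s) w ⟧ * g (x ∷ w))
  factor x = trans (∑W-cong k n (λ w _ _ → trans (cong (_* g (x ∷ w)) (⟦∧⟧ (x <ᵇ s) _)) (*-assoc ⟦ x <ᵇ s ⟧ _ _)))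
                   (∑W-*ˡ k n ⟦ x <ᵇ s ⟧ _)

∑W-firstOccurrence : ∀ k m n (g : List ℕ → ℕ) → m ≤ k →
  ∑W k n (λ σ → ⟦ m ∈ᵇ σ ⟧ * g σ) ≡
  ∑< (λ q → ∑W k q (λ α → ⟦ m ∉ᵇ α ⟧ * ∑W k (n ∸ suc q) (λ ω → g (α ++ m ∷ ω)))) n
∑W-firstOccurrence k m zero    g _   = refl
∑W-firstOccurrence k m (suc n) g m≤k = begin
  ∑< (λ x → ∑W k n (λ σ → ⟦ (x ≡ᵇ m) ∨ m ∈ᵇ σ ⟧ * g (x ∷ σ))) (suc k)
    ≡⟨ ∑<-cong (suc k) (λ x _ → trans (∑W-cong k n (λ σ _ _ → split x σ)) (∑W-+ k n (headIs-m x) (headIsNot-m x))) ⟩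
  ∑< (λ x → ∑W k n (headIs-m x) + ∑W k n (headIsNot-m x)) (suc k)
    ≡⟨ ∑<-+ (λ x → ∑W k n (headIs-m x)) (λ x → ∑W k n (headIsNot-m x)) (suc k) ⟩
  ∑< (λ x → ∑W k n (headIs-m x)) (suc k) + ∑< (λ x → ∑W k n (headIsNot-m x)) (suc k)
    ≡⟨ cong₂ _+_ sum-headIs-m sum-headIsNot-m ⟩
  ∑W k n (g ∘ (m ∷_)) + ∑< (F ∘ suc) n
    ≡⟨ cong (_+ ∑< (F ∘ suc) n) (+-identityʳ _) ⟨
  ∑< F (suc n) ∎
  where
  F : ℕ → ℕ
  F q = ∑W k q (λ α → ⟦ m ∉ᵇ α ⟧ * ∑W k (suc n ∸ suc q) (λ ω → g (α ++ m ∷ ω)))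
  headIs-m headIsNot-m : ℕ → List ℕ → ℕ
  headIs-m    x σ = ⟦ x ≡ᵇ m ⟧ * g (x ∷ σ)
  headIsNot-m x σ = ⟦ m ∈ᵇ σ ⟧ * (⟦ not (x ≡ᵇ m) ⟧ * g (x ∷ σ))

  split : ∀ x σ → ⟦ (x ≡ᵇ m) ∨ m ∈ᵇ σ ⟧ * g (x ∷ σ) ≡ headIs-m x σ + headIsNot-m x σ
  split x σ with x ≡ᵇ m
  ... | true  = sym (trans (cong (g (x ∷ σ) + 0 +_) (*-zeroʳ ⟦ m ∈ᵇ σ ⟧)) (+-identityʳ _))
  ... | false = cong (⟦ m ∈ᵇ σ ⟧ *_) (sym (+-identityʳ _))

  sum-headIs-m : ∑< (λ x → ∑W k n (headIs-m x)) (suc k) ≡ ∑W k n (g ∘ (m ∷_))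
  sum-headIs-m = begin
    ∑< (λ x → ∑W k n (headIs-m x)) (suc k)            ≡⟨ ∑<-cong (suc k) (λ x _ → ∑W-*ˡ k n ⟦ x ≡ᵇ m ⟧ (g ∘ (x ∷_))) ⟩
    ∑< (λ x → ⟦ x ≡ᵇ m ⟧ * ∑W k n (g ∘ (x ∷_))) (suc k) ≡⟨ ∑<-pick (λ x → ∑W k n (g ∘ (x ∷_))) m (suc k) ⟩
    ⟦ m <ᵇ suc k ⟧ * ∑W k n (g ∘ (m ∷_))              ≡⟨ cong (λ b → ⟦ b ⟧ * ∑W k n (g ∘ (m ∷_))) (<⇒<ᵇ≡true (s≤s m≤k)) ⟩
    1 * ∑W k n (g ∘ (m ∷_))                           ≡⟨ *-identityˡ _ ⟩
    ∑W k n (g ∘ (m ∷_))                               ∎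

  -- a word x ∷ σ with x ≢ m is x ∷ α ++ m ∷ ω, and m does not occur in x ∷ α
  sum-headIsNot-m : ∑< (λ x → ∑W k n (headIsNot-m x)) (suc k) ≡ ∑< (F ∘ suc) n
  sum-headIsNot-m = begin
    ∑< (λ x → ∑W k n (headIsNot-m x)) (suc k)
      ≡⟨ ∑<-cong (suc k) (λ x _ → ∑W-firstOccurrence k m n (λ σ → ⟦ not (x ≡ᵇ m) ⟧ * g (x ∷ σ)) m≤k) ⟩
    ∑< (λ x → ∑< (G x) n) (suc k)                 ≡⟨ ∑<-comm G (suc k) n ⟩
    ∑< (λ q → ∑< (λ x → G x q) (suc k)) n
      ≡⟨ ∑<-cong n (λ q _ → ∑<-cong (suc k) (λ x _ → ∑W-cong k q (λ α _ _ → prepend q x α))) ⟩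
    ∑< (F ∘ suc) n ∎
    where
    G : ℕ → ℕ → ℕ
    G x q = ∑W k q (λ α → ⟦ m ∉ᵇ α ⟧ * ∑W k (n ∸ suc q) (λ ω → ⟦ not (x ≡ᵇ m) ⟧ * g (x ∷ α ++ m ∷ ω)))
    prepend : ∀ q x α → ⟦ m ∉ᵇ α ⟧ * ∑W k (n ∸ suc q) (λ ω → ⟦ not (x ≡ᵇ m) ⟧ * g (x ∷ α ++ m ∷ ω)) ≡
                        ⟦ m ∉ᵇ (x ∷ α) ⟧ * ∑W k (n ∸ suc q) (λ ω → g (x ∷ α ++ m ∷ ω))
    prepend q x α rewrite ∑W-*ˡ k (n ∸ suc q) ⟦ not (x ≡ᵇ m) ⟧ (λ ω → g (x ∷ α ++ m ∷ ω)) with x ≡ᵇ m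
    ... | true  = *-zeroʳ ⟦ m ∉ᵇ α ⟧
    ... | false = cong (⟦ m ∉ᵇ α ⟧ *_) (+-identityʳ _)

any-++ : ∀ {A : Set} (h : A → Bool) xs ys → any h (xs ++ ys) ≡ any h xs ∨ any h ys
any-++ h []       ys = refl
any-++ h (x ∷ xs) ys = trans (cong (h x ∨_) (any-++ h xs ys)) (sym (∨-assoc (h x) _ _))

any-∨ : ∀ {A : Set} (f g : A → Bool) xs → any (λ x → f x ∨ g x) xs ≡ any f xs ∨ any g xs
any-∨ f g []       = refl
any-∨ f g (x ∷ xs) = trans (cong ((f x ∨ g x) ∨_) (any-∨ f g xs)) (∨-interchange (f x) (g x) _ _)

any-map : ∀ {A B : Set} (h : B → Bool) (f : A → B) xs → any h (map f xs) ≡ any (h ∘ f) xs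
any-map h f []       = refl
any-map h f (x ∷ xs) = cong (h (f x) ∨_) (any-map h f xs)

any-≡false : ∀ {A : Set} (h : A → Bool) xs → (∀ x → h x ≡ false) → any h xs ≡ false
any-≡false h []       e = refl
any-≡false h (x ∷ xs) e rewrite e x = any-≡false h xs e

any-subseqs-∷ : ∀ (h : List ℕ → Bool) x xs →
  any h (subseqs (x ∷ xs)) ≡ any (h ∘ (x ∷_)) (subseqs xs) ∨ any h (subseqs xs)
any-subseqs-∷ h x xs =
  trans (any-++ h (map (x ∷_) (subseqs xs)) (subseqs xs)) (cong (_∨ any h (subseqs xs)) (any-map h (x ∷_) (subseqs xs)))

-- Occurrences of 010 and 210

Triple : Set
Triple = ℕ → ℕ → ℕ → Bool

containsTripleFrom : Triple → ℕ → List ℕ → Bool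
containsTripleFrom t a []      = false
containsTripleFrom t a (b ∷ s) = any (t a b) s ∨ containsTripleFrom t a s

containsTriple : Triple → List ℕ → Bool
containsTriple t []      = false
containsTriple t (a ∷ s) = containsTripleFrom t a s ∨ containsTriple t s

completesTriple : Triple → List ℕ → ℕ → Bool
completesTriple t []      v = false
completesTriple t (a ∷ s) v = any (λ b → t a b v) s ∨ completesTriple t s v

containsTriple-∨ : ∀ t u s → containsTriple (λ a b c → t a b c ∨ u a b c) s ≡ containsTriple t s ∨ containsTriple u s
containsTriple-∨ t u []      = refl
containsTriple-∨ t u (a ∷ s) = trans (cong₂ _∨_ (from a s) (containsTriple-∨ t u s))
  (∨-interchange (containsTripleFrom t a s) (containsTripleFrom u a s) (containsTriple t s) (containsTriple u s))
  where
  from : ∀ a s → containsTripleFrom (λ a b c → t a b c ∨ u a b c) a s ≡ containsTripleFrom t a s ∨ containsTripleFrom u a s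
  from a []      = refl
  from a (b ∷ s) = trans (cong₂ _∨_ (any-∨ (t a b) (u a b) s) (from a s))
    (∨-interchange (any (t a b) s) (any (u a b) s) (containsTripleFrom t a s) (containsTripleFrom u a s))

containsTripleFrom-snoc : ∀ t a s v → containsTripleFrom t a (s ++ v ∷ []) ≡ containsTripleFrom t a s ∨ any (λ b → t a b v) s
containsTripleFrom-snoc t a []      v = refl
containsTripleFrom-snoc t a (b ∷ s) v = begin
  any (t a b) (s ++ v ∷ []) ∨ containsTripleFrom t a (s ++ v ∷ [])
    ≡⟨ cong₂ _∨_ (any-++ (t a b) s (v ∷ [])) (containsTripleFrom-snoc t a s v) ⟩
  (any (t a b) s ∨ (t a b v ∨ false)) ∨ (containsTripleFrom t a s ∨ any (λ b′ → t a b′ v) s)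
    ≡⟨ cong (λ z → (any (t a b) s ∨ z) ∨ _) (∨-identityʳ (t a b v)) ⟩
  (any (t a b) s ∨ t a b v) ∨ (containsTripleFrom t a s ∨ any (λ b′ → t a b′ v) s)
    ≡⟨ ∨-interchange (any (t a b) s) (t a b v) (containsTripleFrom t a s) (any (λ b′ → t a b′ v) s) ⟩
  (any (t a b) s ∨ containsTripleFrom t a s) ∨ (t a b v ∨ any (λ b′ → t a b′ v) s) ∎

containsTriple-snoc : ∀ t s v → containsTriple t (s ++ v ∷ []) ≡ containsTriple t s ∨ completesTriple t s v
containsTriple-snoc t []      v = refl
containsTriple-snoc t (a ∷ s) v =
  trans (cong₂ _∨_ (containsTripleFrom-snoc t a s v) (containsTriple-snoc t s v))
    (∨-interchange (containsTripleFrom t a s) (any (λ b → t a b v) s) (containsTriple t s) (completesTriple t s v))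

completesTriple-snoc : ∀ t s y v → completesTriple t (s ++ y ∷ []) v ≡ completesTriple t s v ∨ any (λ a → t a y v) s
completesTriple-snoc t []      y v = refl
completesTriple-snoc t (a ∷ s) y v = begin
  any (λ b → t a b v) (s ++ y ∷ []) ∨ completesTriple t (s ++ y ∷ []) v
    ≡⟨ cong₂ _∨_ (any-++ (λ b → t a b v) s (y ∷ [])) (completesTriple-snoc t s y v) ⟩
  (any (λ b → t a b v) s ∨ (t a y v ∨ false)) ∨ (completesTriple t s v ∨ any (λ a′ → t a′ y v) s)
    ≡⟨ cong (λ z → (any (λ b → t a b v) s ∨ z) ∨ _) (∨-identityʳ (t a y v)) ⟩
  (any (λ b → t a b v) s ∨ t a y v) ∨ (completesTriple t s v ∨ any (λ a′ → t a′ y v) s)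
    ≡⟨ ∨-interchange (any (λ b → t a b v) s) (t a y v) (completesTriple t s v) (any (λ a′ → t a′ y v) s) ⟩
  (any (λ b → t a b v) s ∨ completesTriple t s v) ∨ (t a y v ∨ any (λ a′ → t a′ y v) s) ∎

containsTriple-++ : ∀ t s r → containsTriple t s ≡ true → containsTriple t (s ++ r) ≡ true
containsTriple-++ t s []      e rewrite ++-identityʳ s = e
containsTriple-++ t s (y ∷ r) e rewrite sym (++-assoc s (y ∷ []) r) =
  containsTriple-++ t (s ++ y ∷ []) r (trans (containsTriple-snoc t s y) (∨-trueˡ e))

sameComparisons : ℕ × ℕ → ℕ × ℕ → Bool
sameComparisons (x , y) (x′ , y′) = ((x <ᵇ x′) ==ᵇ (y <ᵇ y′)) ∧ ((x ≡ᵇ x′) ==ᵇ (y ≡ᵇ y′))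

orderIso⇒sameComparisons : ∀ xs ys → orderIso xs ys ≡ true →
  All (λ p → All (T ∘ sameComparisons p) (zip xs ys)) (zip xs ys)
orderIso⇒sameComparisons xs ys e =
  All.map (all⁺ _ (zip xs ys)) (all⁺ _ (zip xs ys) (Equivalence.from T-≡ (∧-trueʳ {length xs ≡ᵇ length ys} e)))

==ᵇ-sound : ∀ p q → T (p ==ᵇ q) → p ≡ q
==ᵇ-sound true  true  _ = refl
==ᵇ-sound false false _ = refl

sameComparisons-sound : ∀ x y x′ y′ → T (sameComparisons (x , y) (x′ , y′)) →
  (x <ᵇ x′) ≡ (y <ᵇ y′) × (x ≡ᵇ x′) ≡ (y ≡ᵇ y′)
sameComparisons-sound x y x′ y′ t with (x <ᵇ x′) ==ᵇ (y <ᵇ y′) in lt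
... | true = ==ᵇ-sound _ _ (subst T (sym lt) _) , ==ᵇ-sound _ _ t

triple010 triple210 P-triple : Triple
triple010 a b c = (a ≡ᵇ c) ∧ (a <ᵇ b)
triple210 a b c = (b <ᵇ a) ∧ (c <ᵇ b)
P-triple  a b c = triple010 a b c ∨ triple210 a b c

orderIso-010 : ∀ a b c → orderIso (a ∷ b ∷ c ∷ []) p010 ≡ triple010 a b c
orderIso-010 a b c = true-ext to from
  where
  to : orderIso (a ∷ b ∷ c ∷ []) p010 ≡ true → triple010 a b c ≡ true
  to e with orderIso⇒sameComparisons (a ∷ b ∷ c ∷ []) p010 e
  ... | (_ ∷ ab ∷ ac ∷ []) ∷ _
    rewrite proj₂ (sameComparisons-sound a 0 c 0 ac) | proj₁ (sameComparisons-sound a 0 b 1 ab) = refl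
  from : triple010 a b c ≡ true → orderIso (a ∷ b ∷ c ∷ []) p010 ≡ true
  from e with ≡ᵇ≡true⇒≡ {a} {c} (∧-trueˡ e) | <ᵇ≡true⇒< {a} {b} (∧-trueʳ e)
  ... | refl | a<b
    rewrite <ᵇ-irrefl a | ≡ᵇ-refl a | <ᵇ-irrefl b | ≡ᵇ-refl b | <⇒<ᵇ≡true a<b | ≥⇒<ᵇ≡false (<⇒≤ a<b)
          | ≢⇒≡ᵇ≡false (<⇒≢ a<b) | ≢⇒≡ᵇ≡false (≢-sym (<⇒≢ a<b)) = refl

orderIso-210 : ∀ a b c → orderIso (a ∷ b ∷ c ∷ []) p210 ≡ triple210 a b c
orderIso-210 a b c = true-ext to from
  where
  to : orderIso (a ∷ b ∷ c ∷ []) p210 ≡ true → triple210 a b c ≡ true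
  to e with orderIso⇒sameComparisons (a ∷ b ∷ c ∷ []) p210 e
  ... | _ ∷ (ba ∷ _) ∷ (_ ∷ cb ∷ _) ∷ []
    rewrite proj₁ (sameComparisons-sound b 1 a 2 ba) | proj₁ (sameComparisons-sound c 0 b 1 cb) = refl
  from : triple210 a b c ≡ true → orderIso (a ∷ b ∷ c ∷ []) p210 ≡ true
  from e with <ᵇ≡true⇒< {b} {a} (∧-trueˡ e) | <ᵇ≡true⇒< {c} {b} (∧-trueʳ e)
  ... | b<a | c<b
    rewrite <ᵇ-irrefl a | ≡ᵇ-refl a | <ᵇ-irrefl b | ≡ᵇ-refl b | <ᵇ-irrefl c | ≡ᵇ-refl c
          | <⇒<ᵇ≡true b<a | <⇒<ᵇ≡true c<b | <⇒<ᵇ≡true (<-trans c<b b<a)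
          | ≥⇒<ᵇ≡false (<⇒≤ b<a) | ≥⇒<ᵇ≡false (<⇒≤ c<b) | ≥⇒<ᵇ≡false (<⇒≤ (<-trans c<b b<a))
          | ≢⇒≡ᵇ≡false (<⇒≢ b<a) | ≢⇒≡ᵇ≡false (≢-sym (<⇒≢ b<a))
          | ≢⇒≡ᵇ≡false (<⇒≢ c<b) | ≢⇒≡ᵇ≡false (≢-sym (<⇒≢ c<b))
          | ≢⇒≡ᵇ≡false (<⇒≢ (<-trans c<b b<a)) | ≢⇒≡ᵇ≡false (≢-sym (<⇒≢ (<-trans c<b b<a))) = refl

-- A subsequence is order-isomorphic to a pattern of length three only if it has length three.
module _ (x y z : ℕ) (t : Triple) (orderIso≡t : ∀ a b c → orderIso (a ∷ b ∷ c ∷ []) (x ∷ y ∷ z ∷ []) ≡ t a b c) where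

  private
    iso : List ℕ → Bool
    iso w = orderIso w (x ∷ y ∷ z ∷ [])

    any-subseqs-≡false : ∀ (h : List ℕ → Bool) s → (∀ a w → h (a ∷ w) ≡ false) → any h (subseqs s) ≡ h [] ∨ false
    any-subseqs-≡false h []      e = refl
    any-subseqs-≡false h (a ∷ s) e
      rewrite any-subseqs-∷ h a s | any-≡false (h ∘ (a ∷_)) (subseqs s) (e a) = any-subseqs-≡false h s e

    prefix3 : ∀ a b c s → any (λ w → iso (a ∷ b ∷ c ∷ w)) (subseqs s) ≡ t a b c ∨ false
    prefix3 a b c s =
      trans (any-subseqs-≡false (λ w → iso (a ∷ b ∷ c ∷ w)) s (λ _ _ → refl)) (cong (_∨ false) (orderIso≡t a b c))

    prefix2 : ∀ a b s → any (λ w → iso (a ∷ b ∷ w)) (subseqs s) ≡ any (t a b) s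
    prefix2 a b []      = refl
    prefix2 a b (c ∷ s)
      rewrite any-subseqs-∷ (λ w → iso (a ∷ b ∷ w)) c s | prefix3 a b c s | prefix2 a b s
      = cong (_∨ any (t a b) s) (∨-identityʳ (t a b c))

    prefix1 : ∀ a s → any (λ w → iso (a ∷ w)) (subseqs s) ≡ containsTripleFrom t a s
    prefix1 a []      = refl
    prefix1 a (b ∷ s) rewrite any-subseqs-∷ (λ w → iso (a ∷ w)) b s | prefix2 a b s | prefix1 a s = refl

  contains≡containsTriple : ∀ s → contains (x ∷ y ∷ z ∷ []) s ≡ containsTriple t s
  contains≡containsTriple []      = refl
  contains≡containsTriple (a ∷ s) rewrite any-subseqs-∷ iso a s | prefix1 a s | contains≡containsTriple s = refl

containsP : List ℕ → Bool
containsP = containsTriple P-triple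

completesP : List ℕ → ℕ → Bool
completesP = completesTriple P-triple

contains-010 : ∀ s → contains p010 s ≡ containsTriple triple010 s
contains-010 = contains≡containsTriple 0 1 0 triple010 orderIso-010

containsSome-P : ∀ s → containsSome P s ≡ containsP s
containsSome-P s = begin
  contains p010 s ∨ (contains p210 s ∨ false)                 ≡⟨ cong (contains p010 s ∨_) (∨-identityʳ _) ⟩
  contains p010 s ∨ contains p210 s                           ≡⟨ cong₂ _∨_ (contains-010 s) (contains≡containsTriple 2 1 0 triple210 orderIso-210 s) ⟩
  containsTriple triple010 s ∨ containsTriple triple210 s     ≡⟨ containsTriple-∨ triple010 triple210 s ⟨
  containsP s                                                 ∎

all-true : ∀ (p : ℕ → Bool) {w} → All (λ x → p x ≡ true) w → all p w ≡ true
all-true p []       = refl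
all-true p (e ∷ es) rewrite e = all-true p es

all-true⁻ : ∀ (p : ℕ → Bool) w → all p w ≡ true → All (λ x → p x ≡ true) w
all-true⁻ p []      _ = []
all-true⁻ p (x ∷ w) e = ∧-trueˡ e ∷ all-true⁻ p w (∧-trueʳ e)

all-++ : ∀ (p : ℕ → Bool) xs ys → all p (xs ++ ys) ≡ all p xs ∧ all p ys
all-++ p []       ys = refl
all-++ p (x ∷ xs) ys rewrite all-++ p xs ys = sym (∧-assoc (p x) _ _)

all-∧ : ∀ (p q : ℕ → Bool) w → all p w ∧ all q w ≡ all (λ x → p x ∧ q x) w
all-∧ p q []      = refl
all-∧ p q (x ∷ w) rewrite sym (all-∧ p q w) with p x | q x
... | true  | true  = refl
... | true  | false = ∧-zeroʳ _
... | false | _     = refl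

any-≡false-All : ∀ {Q : ℕ → Set} (h : ℕ → Bool) {xs} → All Q xs → (∀ x → Q x → h x ≡ false) → any h xs ≡ false
any-≡false-All h []         e = refl
any-≡false-All h (qx ∷ qxs) e rewrite e _ qx = any-≡false-All h qxs e

any-cong-All : ∀ {Q : ℕ → Set} (f g : ℕ → Bool) {xs} → All Q xs → (∀ x → Q x → f x ≡ g x) → any f xs ≡ any g xs
any-cong-All f g []         e = refl
any-cong-All f g (qx ∷ qxs) e = cong₂ _∨_ (e _ qx) (any-cong-All f g qxs e)

any-witness : ∀ (h : ℕ → Bool) xs → any h xs ≡ true → ∃ λ a → h a ≡ true
any-witness h (x ∷ xs) e with ∨-true⁻ {h x} e
... | inj₁ hx = x , hx
... | inj₂ e′ = any-witness h xs e′

any-∈-++ : ∀ (h : ℕ → Bool) xs y ys → h y ≡ true → any h (xs ++ y ∷ ys) ≡ true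
any-∈-++ h xs y ys e rewrite any-++ h xs (y ∷ ys) | e = ∨-trueʳ {any h xs} refl

∈ᵇ-++ : ∀ v xs ys → v ∈ᵇ (xs ++ ys) ≡ v ∈ᵇ xs ∨ v ∈ᵇ ys
∈ᵇ-++ v = any-++ (_≡ᵇ v)

∈ᵇ-∷ʳ : ∀ v xs y → v ∈ᵇ (xs ++ y ∷ []) ≡ true → v ∈ᵇ xs ≡ true ⊎ y ≡ v
∈ᵇ-∷ʳ v xs y e rewrite ∈ᵇ-++ v xs (y ∷ []) with ∨-true⁻ {v ∈ᵇ xs} e
... | inj₁ v∈xs = inj₁ v∈xs
... | inj₂ y≡v  = inj₂ (≡ᵇ≡true⇒≡ (trans (sym (∨-identityʳ (y ≡ᵇ v))) y≡v))

∈ᵇ-∉ : ∀ v s → All (_≢ v) s → v ∈ᵇ s ≡ false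
∈ᵇ-∉ v s ps = any-≡false-All (_≡ᵇ v) ps (λ a a≢v → ≢⇒≡ᵇ≡false a≢v)

all≤ᵇ all<ᵇ : ℕ → List ℕ → Bool
all≤ᵇ m = all (_<ᵇ suc m)
all<ᵇ m = all (_<ᵇ m)

all≤ᵇ-true : ∀ m {w} → All (_≤ m) w → all≤ᵇ m w ≡ true
all≤ᵇ-true m w≤m = all-true (_<ᵇ suc m) (All.map (<⇒<ᵇ≡true ∘ s≤s) w≤m)

all≤ᵇ⇒All : ∀ m w → all≤ᵇ m w ≡ true → All (_≤ m) w
all≤ᵇ⇒All m w e = All.map (≤-pred ∘ <ᵇ≡true⇒<) (all-true⁻ (_<ᵇ suc m) w e)

all≤ᵇ-false : ∀ m β x γ → m < x → all≤ᵇ m (β ++ x ∷ γ) ≡ false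
all≤ᵇ-false m []      x γ m<x rewrite ≥⇒<ᵇ≡false {x} {suc m} m<x = refl
all≤ᵇ-false m (y ∷ β) x γ m<x rewrite all≤ᵇ-false m β x γ m<x = ∧-zeroʳ (y <ᵇ suc m)

all<ᵇ-true : ∀ m {w} → All (_< m) w → all<ᵇ m w ≡ true
all<ᵇ-true m w<m = all-true (_<ᵇ m) (All.map <⇒<ᵇ≡true w<m)

all<ᵇ⇒All : ∀ m w → all<ᵇ m w ≡ true → All (_< m) w
all<ᵇ⇒All m w e = All.map <ᵇ≡true⇒< (all-true⁻ (_<ᵇ m) w e)

∉ᵇ∧all≤ᵇ : ∀ m w → m ∉ᵇ w ∧ all≤ᵇ m w ≡ all<ᵇ m w
∉ᵇ∧all≤ᵇ m w = trans (all-∧ _ _ w) (cong-all w)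
  where
  pointwise : ∀ x → not (x ≡ᵇ m) ∧ (x <ᵇ suc m) ≡ (x <ᵇ m)
  pointwise x with <-cmp x m
  ... | tri< x<m _ _ rewrite ≢⇒≡ᵇ≡false (<⇒≢ x<m) | <⇒<ᵇ≡true (m≤n⇒m≤1+n x<m) | <⇒<ᵇ≡true x<m = refl
  ... | tri≈ _ refl _ rewrite ≡ᵇ-refl x | <ᵇ-irrefl x = refl
  ... | tri> _ _ m<x rewrite ≢⇒≡ᵇ≡false (≢-sym (<⇒≢ m<x)) | ≥⇒<ᵇ≡false {x} {suc m} m<x | ≥⇒<ᵇ≡false (<⇒≤ m<x) = refl
  cong-all : ∀ w → all (λ x → not (x ≡ᵇ m) ∧ (x <ᵇ suc m)) w ≡ all<ᵇ m w
  cong-all []      = refl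
  cong-all (x ∷ w) = cong₂ _∧_ (pointwise x) (cong-all w)

∈ᵇ⇒∈ : ∀ x xs → x ∈ᵇ xs ≡ true → x ∈ xs
∈ᵇ⇒∈ x (z ∷ zs) e with ∨-true⁻ {z ≡ᵇ x} e
... | inj₁ z≡x = here (sym (≡ᵇ≡true⇒≡ z≡x))
... | inj₂ e′  = there (∈ᵇ⇒∈ x zs e′)

≤-maxℕ : ∀ y ys → All (_≤ maxℕ (y ∷ ys)) (y ∷ ys)
≤-maxℕ y []       = ≤-refl ∷ []
≤-maxℕ y (z ∷ zs) with ≤-maxℕ y zs
... | y≤ ∷ zs≤ = ≤-trans y≤ (m≤n⊔m z _) ∷ m≤m⊔n z _ ∷ All.map (λ q → ≤-trans q (m≤n⊔m z _)) zs≤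

maxℕ-∈ : ∀ y ys → maxℕ (y ∷ ys) ∈ᵇ (y ∷ ys) ≡ true
maxℕ-∈ y []       rewrite ≡ᵇ-refl y = refl
maxℕ-∈ y (z ∷ zs) with ≤-total z (maxℕ (y ∷ zs))
... | inj₁ z≤M rewrite m≤n⇒m⊔n≡n z≤M with ∨-true⁻ {y ≡ᵇ maxℕ (y ∷ zs)} (maxℕ-∈ y zs)
...   | inj₁ e = ∨-trueˡ e
...   | inj₂ e = ∨-trueʳ {y ≡ᵇ _} (∨-trueʳ {z ≡ᵇ _} e)
maxℕ-∈ y (z ∷ zs) | inj₂ M≤z rewrite m≥n⇒m⊔n≡m M≤z | ≡ᵇ-refl z = ∨-trueʳ {y ≡ᵇ z} refl

All-maxℕ : ∀ {P : ℕ → Set} y ys → All P (y ∷ ys) → P (maxℕ (y ∷ ys))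
All-maxℕ y ys ps = All.lookup ps (∈ᵇ⇒∈ _ (y ∷ ys) (maxℕ-∈ y ys))

maxℕ-≡ : ∀ m y ys → All (_≤ m) (y ∷ ys) → m ∈ᵇ (y ∷ ys) ≡ true → maxℕ (y ∷ ys) ≡ m
maxℕ-≡ m y ys ≤m m∈ = ≤-antisym (All-maxℕ y ys ≤m) (All.lookup (≤-maxℕ y ys) (∈ᵇ⇒∈ m (y ∷ ys) m∈))

all<ᵇ≡maxℕ<ᵇ : ∀ m y ys → all<ᵇ m (y ∷ ys) ≡ (maxℕ (y ∷ ys) <ᵇ m)
all<ᵇ≡maxℕ<ᵇ m y ys = true-ext
  (λ e → <⇒<ᵇ≡true (All-maxℕ y ys (all<ᵇ⇒All m (y ∷ ys) e)))
  (λ e → all<ᵇ-true m (All.map (λ q → ≤-<-trans q (<ᵇ≡true⇒< e)) (≤-maxℕ y ys)))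

maxIs≡∈ᵇ∧all≤ᵇ : ∀ σ m → maxIs σ m ≡ m ∈ᵇ σ ∧ all≤ᵇ m σ
maxIs≡∈ᵇ∧all≤ᵇ []       m = refl
maxIs≡∈ᵇ∧all≤ᵇ (y ∷ ys) m = true-ext to from
  where
  to : maxIs (y ∷ ys) m ≡ true → m ∈ᵇ (y ∷ ys) ∧ all≤ᵇ m (y ∷ ys) ≡ true
  to e with ≡ᵇ≡true⇒≡ {maxℕ (y ∷ ys)} {m} e
  ... | refl = ∧-true {maxℕ (y ∷ ys) ∈ᵇ (y ∷ ys)} (maxℕ-∈ y ys) (all≤ᵇ-true _ (≤-maxℕ y ys))
  from : m ∈ᵇ (y ∷ ys) ∧ all≤ᵇ m (y ∷ ys) ≡ true → maxIs (y ∷ ys) m ≡ true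
  from e rewrite maxℕ-≡ m y ys (all≤ᵇ⇒All m (y ∷ ys) (∧-trueʳ {m ∈ᵇ (y ∷ ys)} e)) (∧-trueˡ e) = ≡ᵇ-refl m

P-triple-≥ : ∀ a {b v} → b ≤ v → P-triple a b v ≡ false
P-triple-≥ a {b} {v} b≤v rewrite ≥⇒<ᵇ≡false {v} {b} b≤v | ∧-zeroʳ (b <ᵇ a) with a ≡ᵇ v in a≡v
... | false = refl
... | true rewrite ≡ᵇ≡true⇒≡ {a} {v} a≡v | ≥⇒<ᵇ≡false {v} {b} b≤v = refl

completesP-≥ : ∀ s {v} → All (_≤ v) s → completesP s v ≡ false
completesP-≥ []      _           = refl
completesP-≥ (a ∷ s) (_ ∷ s≤v) rewrite any-≡false-All (λ b → P-triple a b _) s≤v (λ b b≤v → P-triple-≥ a b≤v) =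
  completesP-≥ s s≤v

P-triple-maxMiddle : ∀ {a M} v → a < M → P-triple a M v ≡ (a ≡ᵇ v)
P-triple-maxMiddle {a} {M} v a<M rewrite <⇒<ᵇ≡true a<M | ≥⇒<ᵇ≡false {M} {a} (<⇒≤ a<M) =
  trans (∨-identityʳ _) (∧-identityʳ (a ≡ᵇ v))

P-triple-maxMiddle′ : ∀ {a m v} → a ≤ m → v < m → P-triple a m v ≡ (a ≡ᵇ v)
P-triple-maxMiddle′ {a} {m} {v} a≤m v<m with m≤n⇒m<n∨m≡n a≤m
... | inj₁ a<m = P-triple-maxMiddle v a<m
... | inj₂ refl rewrite <ᵇ-irrefl a | ≢⇒≡ᵇ≡false (≢-sym (<⇒≢ v<m)) = refl

forbᵇ : List ℕ → ℕ → Bool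
forbᵇ α v = completesP α v ∨ v ∈ᵇ α

containsP-++-max-∷ : ∀ s M v → All (_< M) s → containsP (s ++ M ∷ v ∷ []) ≡ containsP s ∨ forbᵇ s v
containsP-++-max-∷ s M v s<M = begin
  containsP (s ++ M ∷ v ∷ [])                          ≡⟨ cong containsP (++-assoc s (M ∷ []) (v ∷ [])) ⟨
  containsP ((s ++ M ∷ []) ++ v ∷ [])                  ≡⟨ containsTriple-snoc P-triple (s ++ M ∷ []) v ⟩
  containsP (s ++ M ∷ []) ∨ completesP (s ++ M ∷ []) v
    ≡⟨ cong₂ _∨_ (containsTriple-snoc P-triple s M) (completesTriple-snoc P-triple s M v) ⟩
  (containsP s ∨ completesP s M) ∨ (completesP s v ∨ any (λ a → P-triple a M v) s)
    ≡⟨ cong₂ (λ u w → (containsP s ∨ u) ∨ (completesP s v ∨ w))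
             (completesP-≥ s (All.map <⇒≤ s<M)) (any-cong-All _ (_≡ᵇ v) s<M (λ a → P-triple-maxMiddle v)) ⟩
  (containsP s ∨ false) ∨ forbᵇ s v                    ≡⟨ cong (_∨ forbᵇ s v) (∨-identityʳ (containsP s)) ⟩
  containsP s ∨ forbᵇ s v                              ∎

-- forbidden tests with the new maximum M = maxℕ α + 1, which exceeds every entry of α.
forbidden-P : ∀ α v → containsP α ≡ false → forbidden P α v ≡ forbᵇ α v
forbidden-P α v α-avoids = begin
  containsSome P (α ++ suc (maxℕ α) ∷ v ∷ [])    ≡⟨ containsSome-P (α ++ suc (maxℕ α) ∷ v ∷ []) ⟩
  containsP (α ++ suc (maxℕ α) ∷ v ∷ [])         ≡⟨ containsP-++-max-∷ α _ v (<-maxℕ α) ⟩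
  containsP α ∨ forbᵇ α v                        ≡⟨ cong (_∨ forbᵇ α v) α-avoids ⟩
  forbᵇ α v                                      ∎
  where
  <-maxℕ : ∀ α → All (_< suc (maxℕ α)) α
  <-maxℕ []       = []
  <-maxℕ (y ∷ ys) = All.map s≤s (≤-maxℕ y ys)

forbCount-P : ∀ σ m → All (_≤ m) σ → m ∈ᵇ σ ≡ true → containsP σ ≡ false →
  forbCount P σ ≡ ∑< (⟦_⟧ ∘ forbᵇ σ) (suc m)
forbCount-P (y ∷ ys) m σ≤m m∈σ σ-avoids = begin
  forbCount P (y ∷ ys)                                  ≡⟨ countB≡sum _ (upTo (suc M)) ⟩
  sum (map (⟦_⟧ ∘ forbidden P (y ∷ ys)) (upTo (suc M))) ≡⟨ sum-applyUpTo _ (λ x → x) (suc M) ⟩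
  ∑< (⟦_⟧ ∘ forbidden P (y ∷ ys)) (suc M)               ≡⟨ ∑<-cong (suc M) (λ v _ → cong ⟦_⟧ (forbidden-P (y ∷ ys) v σ-avoids)) ⟩
  ∑< (⟦_⟧ ∘ forbᵇ (y ∷ ys)) (suc M)                     ≡⟨ cong (∑< (⟦_⟧ ∘ forbᵇ (y ∷ ys)) ∘ suc) (maxℕ-≡ m y ys σ≤m m∈σ) ⟩
  ∑< (⟦_⟧ ∘ forbᵇ (y ∷ ys)) (suc m)                     ∎
  where M = maxℕ (y ∷ ys)

-- The tails after the first maximum

-- The automaton reading the tail β of σ = α · m · β (m = max σ) keeps the last letter c < m of β:
-- low c while no m has followed it, high c afterwards.
data State : Set where
  start : State
  low high : ℕ → State

readTop : State → State
readTop start    = start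
readTop (low c)  = high c
readTop (high c) = high c

read : ℕ → State → ℕ → State
read m s x = if x ≡ᵇ m then readTop s else low x

LastLow : State → ℕ → Set
LastLow start    c = ⊥
LastLow (low c′)  c = c′ ≡ c
LastLow (high c′) c = c′ ≡ c

allowedAfter : State → ℕ → Bool
allowedAfter start    x = true
allowedAfter (low c)  x = c <ᵇ suc x
allowedAfter (high c) x = c <ᵇ x

blockedAfter : State → ℕ → Bool
blockedAfter start    x = false
blockedAfter (low c)  x = x <ᵇ c
blockedAfter (high c) x = x <ᵇ suc c

upToLast : State → ℕ → Bool
upToLast start    x = false
upToLast (low c)  x = x <ᵇ suc c
upToLast (high c) x = x <ᵇ suc c

-- the letters x ≤ m that may follow, when the values in fb are forbidden by α
allowed : ℕ → (ℕ → Bool) → State → ℕ → Bool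
allowed m fb s x = (x ≡ᵇ m) ∨ ((x <ᵇ m) ∧ (not (fb x) ∧ allowedAfter s x))

tails : ℕ → (ℕ → Bool) → (State → ℕ) → ℕ → State → ℕ
tails m fb acc zero    s = acc s
tails m fb acc (suc L) s = ∑< (λ x → ⟦ allowed m fb s x ⟧ * tails m fb acc L (read m s x)) (suc m)

read-top : ∀ m s → read m s m ≡ readTop s
read-top m s rewrite ≡ᵇ-refl m = refl

read-low : ∀ {m} s {x} → x < m → read m s x ≡ low x
read-low s x<m rewrite ≢⇒≡ᵇ≡false (<⇒≢ x<m) = refl

allowed-low : ∀ {m} fb s {x} → x < m → allowed m fb s x ≡ not (fb x) ∧ allowedAfter s x
allowed-low fb s x<m rewrite ≢⇒≡ᵇ≡false (<⇒≢ x<m) | <⇒<ᵇ≡true x<m = refl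

allowed⇒≤ : ∀ m fb s x → allowed m fb s x ≡ true → x ≤ m
allowed⇒≤ m fb s x e with ∨-true⁻ {x ≡ᵇ m} e
... | inj₁ x≡m = ≤-reflexive (≡ᵇ≡true⇒≡ x≡m)
... | inj₂ x<m = <⇒≤ (<ᵇ≡true⇒< (∧-trueˡ x<m))

allowed-> : ∀ m fb s x → m < x → allowed m fb s x ≡ false
allowed-> m fb s x m<x rewrite ≢⇒≡ᵇ≡false (≢-sym (<⇒≢ m<x)) | ≥⇒<ᵇ≡false (<⇒≤ m<x) = refl

<ᵇ-suc : ∀ c x → (c <ᵇ suc x) ≡ not (x <ᵇ c)
<ᵇ-suc zero    x       = refl
<ᵇ-suc (suc c) zero    = refl
<ᵇ-suc (suc c) (suc x) = <ᵇ-suc c x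

allowedAfter≡not-blockedAfter : ∀ s x → allowedAfter s x ≡ not (blockedAfter s x)
allowedAfter≡not-blockedAfter start    x = refl
allowedAfter≡not-blockedAfter (low c)  x = <ᵇ-suc c x
allowedAfter≡not-blockedAfter (high c) x = trans (sym (not-involutive (c <ᵇ x))) (cong not (sym (<ᵇ-suc x c)))

blockedAfter-readTop : ∀ s y → blockedAfter s y ≡ true → blockedAfter (readTop s) y ≡ true
blockedAfter-readTop (low c)  y e = <⇒<ᵇ≡true (m≤n⇒m≤1+n (<ᵇ≡true⇒< {y} {c} e))
blockedAfter-readTop (high c) y e = e

upToLast⇒blockedAfter-readTop : ∀ s y → upToLast s y ≡ true → blockedAfter (readTop s) y ≡ true
upToLast⇒blockedAfter-readTop (low c)  y e = e
upToLast⇒blockedAfter-readTop (high c) y e = e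

upToLast-readTop : ∀ s y → upToLast (readTop s) y ≡ upToLast s y
upToLast-readTop start    y = refl
upToLast-readTop (low c)  y = refl
upToLast-readTop (high c) y = refl

blockedAfter⇒upToLast : ∀ s y → blockedAfter s y ≡ true → upToLast s y ≡ true
blockedAfter⇒upToLast (low c)  y e = <⇒<ᵇ≡true (m≤n⇒m≤1+n (<ᵇ≡true⇒< {y} {c} e))
blockedAfter⇒upToLast (high c) y e = e

blockedAfter-allowedAfter : ∀ s {x y} → allowedAfter s x ≡ true → blockedAfter s y ≡ true → y < x
blockedAfter-allowedAfter (low c)  {x} {y} c≤x y<c  = <-≤-trans (<ᵇ≡true⇒< {y} {c} y<c) (≤-pred (<ᵇ≡true⇒< {c} {suc x} c≤x))
blockedAfter-allowedAfter (high c) {x} {y} c<x y≤c = ≤-<-trans (≤-pred (<ᵇ≡true⇒< {y} {suc c} y≤c)) (<ᵇ≡true⇒< {c} {x} c<x)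

upToLast-allowedAfter : ∀ s {x y} → allowedAfter s x ≡ true → upToLast s y ≡ true → y ≤ x
upToLast-allowedAfter (low c)  {x} {y} c≤x y≤c = ≤-trans (≤-pred (<ᵇ≡true⇒< {y} {suc c} y≤c)) (≤-pred (<ᵇ≡true⇒< {c} {suc x} c≤x))
upToLast-allowedAfter (high c) {x} {y} c<x y≤c = ≤-trans (≤-pred (<ᵇ≡true⇒< {y} {suc c} y≤c)) (<⇒≤ (<ᵇ≡true⇒< {c} {x} c<x))

LastLow-readTop : ∀ s {c} → LastLow (readTop s) c → LastLow s c
LastLow-readTop (low c′)  e = e
LastLow-readTop (high c′) e = e

tails-cong : ∀ m fb {acc acc′ : State → ℕ} L s → (∀ s → acc s ≡ acc′ s) → tails m fb acc L s ≡ tails m fb acc′ L s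
tails-cong m fb zero    s e = e s
tails-cong m fb (suc L) s e = ∑<-cong (suc m) (λ x _ → cong (⟦ allowed m fb s x ⟧ *_) (tails-cong m fb L (read m s x) e))

tails-≡0 : ∀ m fb {acc : State → ℕ} L s → (∀ s → acc s ≡ 0) → tails m fb acc L s ≡ 0
tails-≡0 m fb zero    s e = e s
tails-≡0 m fb (suc L) s e =
  ∑<-≡0 (suc m) (λ x _ → trans (cong (⟦ allowed m fb s x ⟧ *_) (tails-≡0 m fb L (read m s x) e)) (*-zeroʳ ⟦ allowed m fb s x ⟧))

rank : (ℕ → Bool) → ℕ → ℕ
rank fb c = ∑< (λ v → ⟦ not (fb v) ⟧) (suc c)

rankOfLast : (ℕ → Bool) → State → ℕ
rankOfLast fb start    = 0
rankOfLast fb (low c)  = rank fb c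
rankOfLast fb (high c) = rank fb c

module Tail (α : List ℕ) (m : ℕ) (α<m : All (_< m) α) where

  σ : List ℕ → List ℕ
  σ β = α ++ m ∷ β

  σ-∷ʳ : ∀ β x → σ (β ++ x ∷ []) ≡ σ β ++ x ∷ []
  σ-∷ʳ β x = sym (++-assoc α (m ∷ β) (x ∷ []))

  σ≤m : ∀ {β} → All (_≤ m) β → All (_≤ m) (σ β)
  σ≤m β≤m = ++⁺ (All.map <⇒≤ α<m) (≤-refl ∷ β≤m)

  m∈σ : ∀ β → m ∈ᵇ σ β ≡ true
  m∈σ β = any-∈-++ (_≡ᵇ m) α m β (≡ᵇ-refl m)

  record Tracks (β : List ℕ) (s : State) : Set where
    field
      completes-σ : ∀ x → x < m → completesP (σ β) x ≡ forbᵇ α x ∨ blockedAfter s x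
      ∈-σ         : ∀ x → x < m → x ∈ᵇ σ β ≡ true → forbᵇ α x ∨ upToLast s x ≡ true
      last∈σ      : ∀ c → LastLow s c → c ∈ᵇ σ β ≡ true × c < m
  open Tracks public

  tracks-[] : Tracks [] start
  tracks-[] = record { completes-σ = completes ; ∈-σ = ∈σ ; last∈σ = λ _ () }
    where
    completes : ∀ x → x < m → completesP (σ []) x ≡ forbᵇ α x ∨ false
    completes x x<m = begin
      completesP (α ++ m ∷ []) x                       ≡⟨ completesTriple-snoc P-triple α m x ⟩
      completesP α x ∨ any (λ a → P-triple a m x) α
        ≡⟨ cong (completesP α x ∨_) (any-cong-All _ (_≡ᵇ x) α<m (λ a a<m → P-triple-maxMiddle′ (<⇒≤ a<m) x<m)) ⟩
      forbᵇ α x                                        ≡⟨ ∨-identityʳ (forbᵇ α x) ⟨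
      forbᵇ α x ∨ false                                ∎
    ∈σ : ∀ x → x < m → x ∈ᵇ σ [] ≡ true → forbᵇ α x ∨ false ≡ true
    ∈σ x x<m e with ∈ᵇ-∷ʳ x α m e
    ... | inj₁ x∈α = ∨-trueˡ (∨-trueʳ {completesP α x} x∈α)
    ... | inj₂ refl = ⊥-elim (<-irrefl refl x<m)

  module _ {β : List ℕ} {s : State} (I : Tracks β s) (β≤m : All (_≤ m) β) where

    allowed≡not-completesP : ∀ x → x ≤ m → allowed m (forbᵇ α) s x ≡ not (completesP (σ β) x)
    allowed≡not-completesP x x≤m with m≤n⇒m<n∨m≡n x≤m
    ... | inj₂ refl rewrite ≡ᵇ-refl x | completesP-≥ (σ β) (σ≤m β≤m) = refl
    ... | inj₁ x<m rewrite allowed-low (forbᵇ α) s x<m | completes-σ I x x<m | allowedAfter≡not-blockedAfter s x =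
      sym (not-∨ (forbᵇ α x) (blockedAfter s x))

    avoids-∷ʳ : ∀ x → x ≤ m → containsP (σ β) ≡ false → allowed m (forbᵇ α) s x ≡ true →
                containsP (σ (β ++ x ∷ [])) ≡ false
    avoids-∷ʳ x x≤m σ-avoids ok rewrite σ-∷ʳ β x | containsTriple-snoc P-triple (σ β) x | σ-avoids =
      trans (sym (not-involutive _)) (cong not (trans (sym (allowed≡not-completesP x x≤m)) ok))

    tracks-∷ʳ-top : Tracks (β ++ m ∷ []) (readTop s)
    tracks-∷ʳ-top = record { completes-σ = completes ; ∈-σ = ∈σ ; last∈σ = last }
      where
      completes : ∀ y → y < m → completesP (σ (β ++ m ∷ [])) y ≡ forbᵇ α y ∨ blockedAfter (readTop s) y
      completes y y<m
        rewrite σ-∷ʳ β m | completesTriple-snoc P-triple (σ β) m y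
              | any-cong-All (λ a → P-triple a m y) (_≡ᵇ y) (σ≤m β≤m) (λ a a≤m → P-triple-maxMiddle′ a≤m y<m)
              | completes-σ I y y<m = true-ext to from
        where
        to : (forbᵇ α y ∨ blockedAfter s y) ∨ y ∈ᵇ σ β ≡ true → forbᵇ α y ∨ blockedAfter (readTop s) y ≡ true
        to e with ∨-true⁻ {forbᵇ α y ∨ blockedAfter s y} e
        ... | inj₁ e′ with ∨-true⁻ {forbᵇ α y} e′
        ...   | inj₁ forb    = ∨-trueˡ forb
        ...   | inj₂ blocked = ∨-trueʳ {forbᵇ α y} (blockedAfter-readTop s y blocked)
        to e | inj₂ y∈σ with ∨-true⁻ {forbᵇ α y} (∈-σ I y y<m y∈σ)
        ...   | inj₁ forb = ∨-trueˡ forb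
        ...   | inj₂ y≤c  = ∨-trueʳ {forbᵇ α y} (upToLast⇒blockedAfter-readTop s y y≤c)
        from : forbᵇ α y ∨ blockedAfter (readTop s) y ≡ true → (forbᵇ α y ∨ blockedAfter s y) ∨ y ∈ᵇ σ β ≡ true
        from e with ∨-true⁻ {forbᵇ α y} e
        ... | inj₁ forb = ∨-trueˡ (∨-trueˡ forb)
        ... | inj₂ blocked = by-state s blocked I
          where
          by-state : ∀ s′ → blockedAfter (readTop s′) y ≡ true → Tracks β s′ → (forbᵇ α y ∨ blockedAfter s′ y) ∨ y ∈ᵇ σ β ≡ true
          by-state (high c) y≤c _ = ∨-trueˡ (∨-trueʳ {forbᵇ α y} y≤c)
          by-state (low c)  y≤c I′ with m≤n⇒m<n∨m≡n (≤-pred (<ᵇ≡true⇒< {y} {suc c} y≤c))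
          ... | inj₁ y<c  = ∨-trueˡ (∨-trueʳ {forbᵇ α y} (<⇒<ᵇ≡true y<c))
          ... | inj₂ refl = ∨-trueʳ {forbᵇ α y ∨ blockedAfter (low y) y} (proj₁ (last∈σ I′ y refl))
      ∈σ : ∀ y → y < m → y ∈ᵇ σ (β ++ m ∷ []) ≡ true → forbᵇ α y ∨ upToLast (readTop s) y ≡ true
      ∈σ y y<m e rewrite σ-∷ʳ β m | upToLast-readTop s y with ∈ᵇ-∷ʳ y (σ β) m e
      ... | inj₁ y∈σ = ∈-σ I y y<m y∈σ
      ... | inj₂ refl = ⊥-elim (<-irrefl refl y<m)
      last : ∀ c → LastLow (readTop s) c → c ∈ᵇ σ (β ++ m ∷ []) ≡ true × c < m
      last c lastLow with last∈σ I c (LastLow-readTop s lastLow)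
      ... | c∈σ , c<m rewrite σ-∷ʳ β m | ∈ᵇ-++ c (σ β) (m ∷ []) | c∈σ = refl , c<m

    tracks-∷ʳ-low : ∀ x → x < m → allowed m (forbᵇ α) s x ≡ true → Tracks (β ++ x ∷ []) (low x)
    tracks-∷ʳ-low x x<m ok = record { completes-σ = completes ; ∈-σ = ∈σ ; last∈σ = last }
      where
      allowed-s : allowedAfter s x ≡ true
      allowed-s = ∧-trueʳ {not (forbᵇ α x)} (trans (sym (allowed-low (forbᵇ α) s x<m)) ok)
      completes : ∀ y → y < m → completesP (σ (β ++ x ∷ [])) y ≡ forbᵇ α y ∨ (y <ᵇ x)
      completes y y<m rewrite σ-∷ʳ β x | completesTriple-snoc P-triple (σ β) x y | completes-σ I y y<m = true-ext to from
        where
        to : (forbᵇ α y ∨ blockedAfter s y) ∨ any (λ a → P-triple a x y) (σ β) ≡ true → forbᵇ α y ∨ (y <ᵇ x) ≡ true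
        to e with ∨-true⁻ {forbᵇ α y ∨ blockedAfter s y} e
        ... | inj₁ e′ with ∨-true⁻ {forbᵇ α y} e′
        ...   | inj₁ forb    = ∨-trueˡ forb
        ...   | inj₂ blocked = ∨-trueʳ {forbᵇ α y} (<⇒<ᵇ≡true (blockedAfter-allowedAfter s allowed-s blocked))
        to e | inj₂ e′ with any-witness (λ a → P-triple a x y) (σ β) e′
        ...   | a , axy with ∨-true⁻ {triple010 a x y} axy
        ...     | inj₁ a≡y∧a<x =
          ∨-trueʳ {forbᵇ α y} (subst (λ z → (z <ᵇ x) ≡ true) (≡ᵇ≡true⇒≡ {a} {y} (∧-trueˡ a≡y∧a<x)) (∧-trueʳ a≡y∧a<x))
        ...     | inj₂ x<a∧y<x = ∨-trueʳ {forbᵇ α y} (∧-trueʳ x<a∧y<x)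
        from : forbᵇ α y ∨ (y <ᵇ x) ≡ true → (forbᵇ α y ∨ blockedAfter s y) ∨ any (λ a → P-triple a x y) (σ β) ≡ true
        from e with ∨-true⁻ {forbᵇ α y} e
        ... | inj₁ forb = ∨-trueˡ (∨-trueˡ forb)
        ... | inj₂ y<x  = ∨-trueʳ {forbᵇ α y ∨ blockedAfter s y} (any-∈-++ (λ a → P-triple a x y) α m β m-x-y)
          where
          -- m, x, y is an occurrence of 210
          m-x-y : P-triple m x y ≡ true
          m-x-y rewrite <⇒<ᵇ≡true x<m | y<x = ∨-trueʳ {triple010 m x y} refl
      ∈σ : ∀ y → y < m → y ∈ᵇ σ (β ++ x ∷ []) ≡ true → forbᵇ α y ∨ (y <ᵇ suc x) ≡ true
      ∈σ y y<m e rewrite σ-∷ʳ β x with ∈ᵇ-∷ʳ y (σ β) x e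
      ... | inj₂ refl = ∨-trueʳ {forbᵇ α y} (<⇒<ᵇ≡true (≤-refl {suc y}))
      ... | inj₁ y∈σ with ∨-true⁻ {forbᵇ α y} (∈-σ I y y<m y∈σ)
      ...   | inj₁ forb = ∨-trueˡ forb
      ...   | inj₂ y≤c  = ∨-trueʳ {forbᵇ α y} (<⇒<ᵇ≡true (s≤s (upToLast-allowedAfter s allowed-s y≤c)))
      last : ∀ c → x ≡ c → c ∈ᵇ σ (β ++ x ∷ []) ≡ true × c < m
      last c refl rewrite σ-∷ʳ β x | ∈ᵇ-++ x (σ β) (x ∷ []) | ≡ᵇ-refl x = ∨-trueʳ {x ∈ᵇ σ β} refl , x<m

    tracks-∷ʳ : ∀ x → x ≤ m → allowed m (forbᵇ α) s x ≡ true → Tracks (β ++ x ∷ []) (read m s x)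
    tracks-∷ʳ x x≤m ok with m≤n⇒m<n∨m≡n x≤m
    ... | inj₂ refl rewrite read-top x s = tracks-∷ʳ-top
    ... | inj₁ x<m  rewrite read-low s x<m = tracks-∷ʳ-low x x<m ok

    disallowed⇒invalid : ∀ x γ → allowed m (forbᵇ α) s x ≡ false →
      containsP (σ (β ++ x ∷ γ)) ≡ true ⊎ all≤ᵇ m (β ++ x ∷ γ) ≡ false
    disallowed⇒invalid x γ not-ok with x ≤? m
    ... | no  x≰m = inj₂ (all≤ᵇ-false m β x γ (≰⇒> x≰m))
    ... | yes x≤m = inj₁ (subst (λ w → containsP w ≡ true) (sym σ-split) (containsTriple-++ P-triple (σ β ++ x ∷ []) γ creates))
      where
      σ-split : σ (β ++ x ∷ γ) ≡ (σ β ++ x ∷ []) ++ γ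
      σ-split = begin
        α ++ m ∷ β ++ x ∷ γ              ≡⟨ cong (λ w → α ++ m ∷ w) (++-assoc β (x ∷ []) γ) ⟨
        α ++ m ∷ (β ++ x ∷ []) ++ γ      ≡⟨ ++-assoc α (m ∷ β ++ x ∷ []) γ ⟨
        (α ++ m ∷ β ++ x ∷ []) ++ γ      ≡⟨ cong (_++ γ) (σ-∷ʳ β x) ⟩
        (σ β ++ x ∷ []) ++ γ             ∎
      completes : completesP (σ β) x ≡ true
      completes = trans (sym (not-involutive _)) (cong not (trans (sym (allowed≡not-completesP x x≤m)) not-ok))
      creates : containsP (σ β ++ x ∷ []) ≡ true
      creates = trans (containsTriple-snoc P-triple (σ β) x) (∨-trueʳ {containsP (σ β)} completes)

  module _ {β : List ℕ} {s : State} (I : Tracks β s) (β≤m : All (_≤ m) β) (σ-avoids : containsP (σ β) ≡ false) where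

    forbᵇ-σ : ∀ v → v < m → forbᵇ (σ β) v ≡ forbᵇ α v ∨ upToLast s v
    forbᵇ-σ v v<m rewrite completes-σ I v v<m = true-ext to from
      where
      to : (forbᵇ α v ∨ blockedAfter s v) ∨ v ∈ᵇ σ β ≡ true → forbᵇ α v ∨ upToLast s v ≡ true
      to e with ∨-true⁻ {forbᵇ α v ∨ blockedAfter s v} e
      ... | inj₂ v∈σ = ∈-σ I v v<m v∈σ
      ... | inj₁ e′ with ∨-true⁻ {forbᵇ α v} e′
      ...   | inj₁ forb    = ∨-trueˡ forb
      ...   | inj₂ blocked = ∨-trueʳ {forbᵇ α v} (blockedAfter⇒upToLast s v blocked)
      from : forbᵇ α v ∨ upToLast s v ≡ true → (forbᵇ α v ∨ blockedAfter s v) ∨ v ∈ᵇ σ β ≡ true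
      from e with ∨-true⁻ {forbᵇ α v} e
      ... | inj₁ forb = ∨-trueˡ (∨-trueˡ forb)
      ... | inj₂ v≤c  = by-state s v≤c I
        where
        by-state : ∀ s′ → upToLast s′ v ≡ true → Tracks β s′ → (forbᵇ α v ∨ blockedAfter s′ v) ∨ v ∈ᵇ σ β ≡ true
        by-state (high c) v≤c _ = ∨-trueˡ (∨-trueʳ {forbᵇ α v} v≤c)
        by-state (low c)  v≤c I′ with m≤n⇒m<n∨m≡n (≤-pred (<ᵇ≡true⇒< {v} {suc c} v≤c))
        ... | inj₁ v<c  = ∨-trueˡ (∨-trueʳ {forbᵇ α v} (<⇒<ᵇ≡true v<c))
        ... | inj₂ refl = ∨-trueʳ {forbᵇ α v ∨ blockedAfter (low v) v} (proj₁ (last∈σ I′ v refl))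

    ∑-free-upToLast : ∑< (λ v → ⟦ not (forbᵇ α v) ⟧ * ⟦ upToLast s v ⟧) m ≡ rankOfLast (forbᵇ α) s
    ∑-free-upToLast = by-state s (last∈σ I)
      where
      restrict : ∀ c → c < m → ∑< (λ v → ⟦ not (forbᵇ α v) ⟧ * ⟦ v <ᵇ suc c ⟧) m ≡ rank (forbᵇ α) c
      restrict c c<m = trans (∑<-cong m (λ v _ → *-comm ⟦ not (forbᵇ α v) ⟧ ⟦ v <ᵇ suc c ⟧))
                             (∑<-restrict (λ v → ⟦ not (forbᵇ α v) ⟧) (suc c) m c<m)
      by-state : ∀ s′ → (∀ c → LastLow s′ c → c ∈ᵇ σ β ≡ true × c < m) →
                 ∑< (λ v → ⟦ not (forbᵇ α v) ⟧ * ⟦ upToLast s′ v ⟧) m ≡ rankOfLast (forbᵇ α) s′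
      by-state start    _    = ∑<-≡0 m (λ v _ → *-zeroʳ ⟦ not (forbᵇ α v) ⟧)
      by-state (low c)  last = restrict c (proj₂ (last c refl))
      by-state (high c) last = restrict c (proj₂ (last c refl))

    forbCount-σ : forbCount P (σ β) ≡ (∑< (⟦_⟧ ∘ forbᵇ α) m + rankOfLast (forbᵇ α) s) + 1
    forbCount-σ = begin
      forbCount P (σ β)
        ≡⟨ forbCount-P (σ β) m (σ≤m β≤m) (m∈σ β) σ-avoids ⟩
      ∑< (⟦_⟧ ∘ forbᵇ (σ β)) (suc m)
        ≡⟨ ∑<-last (⟦_⟧ ∘ forbᵇ (σ β)) m ⟩
      ∑< (⟦_⟧ ∘ forbᵇ (σ β)) m + ⟦ forbᵇ (σ β) m ⟧
        ≡⟨ cong₂ _+_ (∑<-cong m (λ v v<m → cong ⟦_⟧ (forbᵇ-σ v v<m)))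
                     (cong ⟦_⟧ (trans (cong (completesP (σ β) m ∨_) (m∈σ β)) (∨-zeroʳ _))) ⟩
      ∑< (λ v → ⟦ forbᵇ α v ∨ upToLast s v ⟧) m + 1
        ≡⟨ cong (_+ 1) (trans (∑<-cong m (λ v _ → ⟦∨⟧ (forbᵇ α v) (upToLast s v))) (∑<-+ _ _ m)) ⟩
      (∑< (⟦_⟧ ∘ forbᵇ α) m + ∑< (λ v → ⟦ not (forbᵇ α v) ⟧ * ⟦ upToLast s v ⟧) m) + 1
        ≡⟨ cong (λ z → (∑< (⟦_⟧ ∘ forbᵇ α) m + z) + 1) ∑-free-upToLast ⟩
      (∑< (⟦_⟧ ∘ forbᵇ α) m + rankOfLast (forbᵇ α) s) + 1 ∎

  validTail : (List ℕ → Bool) → List ℕ → ℕ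
  validTail Ψ w = ⟦ not (containsP (σ w)) ∧ (all≤ᵇ m w ∧ Ψ w) ⟧

  module _ (n : ℕ) (m≤n : m ≤ n) (Ψ : List ℕ → Bool) (acc : State → ℕ)
           (acc-correct : ∀ {β s} → Tracks β s → All (_≤ m) β → containsP (σ β) ≡ false → ⟦ Ψ β ⟧ ≡ acc s) where

    ∑W-validTail : ∀ L {β s} → Tracks β s → All (_≤ m) β → containsP (σ β) ≡ false →
                   ∑W n L (λ γ → validTail Ψ (β ++ γ)) ≡ tails m (forbᵇ α) acc L s
    ∑W-validTail zero {β} I β≤m σ-avoids rewrite ++-identityʳ β | σ-avoids | all≤ᵇ-true m β≤m = acc-correct I β≤m σ-avoids
    ∑W-validTail (suc L) {β} {s} I β≤m σ-avoids = begin
      ∑< (λ x → ∑W n L (λ γ → validTail Ψ (β ++ x ∷ γ))) (suc n)             ≡⟨ ∑<-cong (suc n) (λ x _ → next x) ⟩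
      ∑< (λ x → ⟦ allowed m (forbᵇ α) s x ⟧ * tails m (forbᵇ α) acc L (read m s x)) (suc n)
        ≡⟨ ∑<-shrink _ (s≤s m≤n) (λ x m<x _ → cong (λ b → ⟦ b ⟧ * tails m (forbᵇ α) acc L (read m s x)) (allowed-> m (forbᵇ α) s x m<x)) ⟩
      tails m (forbᵇ α) acc (suc L) s                                         ∎
      where
      next : ∀ x → ∑W n L (λ γ → validTail Ψ (β ++ x ∷ γ)) ≡ ⟦ allowed m (forbᵇ α) s x ⟧ * tails m (forbᵇ α) acc L (read m s x)
      next x with allowed m (forbᵇ α) s x in ok
      ... | true = begin
        ∑W n L (λ γ → validTail Ψ (β ++ x ∷ γ))           ≡⟨ ∑W-cong n L (λ γ _ _ → cong (validTail Ψ) (++-assoc β (x ∷ []) γ)) ⟨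
        ∑W n L (λ γ → validTail Ψ ((β ++ x ∷ []) ++ γ))
          ≡⟨ ∑W-validTail L (tracks-∷ʳ I β≤m x x≤m ok) (++⁺ β≤m (x≤m ∷ [])) (avoids-∷ʳ I β≤m x x≤m σ-avoids ok) ⟩
        tails m (forbᵇ α) acc L (read m s x)            ≡⟨ +-identityʳ _ ⟨
        1 * tails m (forbᵇ α) acc L (read m s x)        ∎
        where x≤m = allowed⇒≤ m (forbᵇ α) s x ok
      ... | false = ∑W-≡0 n L (λ γ _ _ → invalid γ)
        where
        invalid : ∀ γ → validTail Ψ (β ++ x ∷ γ) ≡ 0
        invalid γ with disallowed⇒invalid I β≤m x γ ok
        ... | inj₁ contains rewrite contains = refl
        ... | inj₂ exceeds  rewrite exceeds = cong ⟦_⟧ (∧-zeroʳ _)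

-- Relabelling by ranks

rankBelow : (ℕ → Bool) → ℕ → ℕ
rankBelow fb c = ∑< (λ v → ⟦ not (fb v) ⟧) c

atRank : (ℕ → Bool) → ℕ → State → ℕ
atRank fb k s = ⟦ rankOfLast fb s ≡ᵇ k ⟧

rank-free : ∀ fb {c} → fb c ≡ false → rank fb c ≡ suc (rankBelow fb c)
rank-free fb {c} fc rewrite ∑<-last (λ v → ⟦ not (fb v) ⟧) c | fc = +-comm _ 1

rank-mono : ∀ fb {c x} → c ≤ x → rank fb c ≤ rank fb x
rank-mono fb c≤x = ∑<-mono (λ v → ⟦ not (fb v) ⟧) (s≤s c≤x)

rank-< : ∀ fb {x c} → x < c → fb c ≡ false → rank fb x < rank fb c
rank-< fb {x} {c} x<c fc rewrite rank-free fb fc = s≤s (∑<-mono (λ v → ⟦ not (fb v) ⟧) x<c)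

rankOfLast-readTop : ∀ fb s → rankOfLast fb (readTop s) ≡ rankOfLast fb s
rankOfLast-readTop fb start    = refl
rankOfLast-readTop fb (low c)  = refl
rankOfLast-readTop fb (high c) = refl

∑<-free : ∀ fb (F : ℕ → ℕ) m → ∑< (λ x → ⟦ not (fb x) ⟧ * F (rank fb x ∸ 1)) m ≡ ∑< F (rankBelow fb m)
∑<-free fb F zero    = refl
∑<-free fb F (suc m) = begin
  ∑< G (suc m)                               ≡⟨ ∑<-last G m ⟩
  ∑< G m + G m                               ≡⟨ cong (_+ G m) (∑<-free fb F m) ⟩
  ∑< F (rankBelow fb m) + G m                ≡⟨ step ⟩
  ∑< F (rankBelow fb m + ⟦ not (fb m) ⟧)     ≡⟨ cong (∑< F) (∑<-last (λ v → ⟦ not (fb v) ⟧) m) ⟨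
  ∑< F (rankBelow fb (suc m))                ∎
  where
  G : ℕ → ℕ
  G x = ⟦ not (fb x) ⟧ * F (rank fb x ∸ 1)
  step : ∑< F (rankBelow fb m) + G m ≡ ∑< F (rankBelow fb m + ⟦ not (fb m) ⟧)
  step rewrite ∑<-last (λ v → ⟦ not (fb v) ⟧) m with not (fb m)
  ... | false = trans (+-identityʳ _) (cong (∑< F) (sym (+-identityʳ (rankBelow fb m))))
  ... | true  = begin
    ∑< F (rankBelow fb m) + (F (rankBelow fb m + 1 ∸ 1) + 0) ≡⟨ cong (∑< F (rankBelow fb m) +_) (trans (+-identityʳ _) (cong F (m+n∸n≡m _ 1))) ⟩
    ∑< F (rankBelow fb m) + F (rankBelow fb m)             ≡⟨ ∑<-last F (rankBelow fb m) ⟨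
    ∑< F (suc (rankBelow fb m))                            ≡⟨ cong (∑< F) (+-comm 1 (rankBelow fb m)) ⟩
    ∑< F (rankBelow fb m + 1)                              ∎

-- Relabelling the free values x < m by their ranks, and m by k, turns allowed tails over {0, …, m}
-- into allowed tails over {0, …, k} with no forbidden values.
module Relabel (m : ℕ) (fb : ℕ → Bool) (k : ℕ) (k≤free : k ≤ rankBelow fb m) where

  Free : State → Set
  Free start    = ⊤
  Free (low c)  = c < m × fb c ≡ false
  Free (high c) = c < m × fb c ≡ false

  Free-readTop : ∀ s → Free s → Free (readTop s)
  Free-readTop start    v = v
  Free-readTop (low c)  v = v
  Free-readTop (high c) v = v

  allowedAfterRank : State → ℕ → Bool
  allowedAfterRank start    r = true
  allowedAfterRank (low c)  r = rank fb c <ᵇ suc r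
  allowedAfterRank (high c) r = rank fb c <ᵇ r

  allowedAfter≡allowedAfterRank : ∀ s x → Free s → fb x ≡ false → allowedAfter s x ≡ allowedAfterRank s (rank fb x)
  allowedAfter≡allowedAfterRank start    x _         _  = refl
  allowedAfter≡allowedAfterRank (low c)  x (_ , fc) fx = true-ext
    (λ c≤x → <⇒<ᵇ≡true (s≤s (rank-mono fb (≤-pred (<ᵇ≡true⇒< {c} {suc x} c≤x)))))
    (λ rc≤rx → <⇒<ᵇ≡true (s≤s (≮⇒≥ (λ x<c → <⇒≱ (rank-< fb x<c fc) (≤-pred (<ᵇ≡true⇒< {rank fb c} {suc (rank fb x)} rc≤rx))))))
  allowedAfter≡allowedAfterRank (high c) x (_ , fc) fx = true-ext
    (λ c<x → <⇒<ᵇ≡true (rank-< fb (<ᵇ≡true⇒< {c} {x} c<x) fx))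
    (λ rc<rx → <⇒<ᵇ≡true {c} {x} (≰⇒> (λ x≤c → <⇒≱ (<ᵇ≡true⇒< {rank fb c} {rank fb x} rc<rx) (rank-mono fb x≤c))))

  rankOfLast-≤ : ∀ s x → allowedAfter s x ≡ true → rankOfLast fb s ≤ rank fb x
  rankOfLast-≤ start    x _   = z≤n
  rankOfLast-≤ (low c)  x c≤x = rank-mono fb (≤-pred (<ᵇ≡true⇒< {c} {suc x} c≤x))
  rankOfLast-≤ (high c) x c<x = rank-mono fb (<⇒≤ (<ᵇ≡true⇒< {c} {x} c<x))

  -- the rank of the last letter never decreases
  tails-aboveRank : ∀ L s → Free s → k < rankOfLast fb s → tails m fb (atRank fb k) L s ≡ 0
  tails-aboveRank zero    s _ k<r rewrite ≢⇒≡ᵇ≡false (≢-sym (<⇒≢ k<r)) = refl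
  tails-aboveRank (suc L) s v k<r = ∑<-≡0 (suc m) (λ x x≤m → next x (≤-pred x≤m))
    where
    next : ∀ x → x ≤ m → ⟦ allowed m fb s x ⟧ * tails m fb (atRank fb k) L (read m s x) ≡ 0
    next x x≤m with m≤n⇒m<n∨m≡n x≤m
    ... | inj₂ refl rewrite read-top x s
      = trans (cong (⟦ allowed x fb s x ⟧ *_) (tails-aboveRank L (readTop s) (Free-readTop s v) (subst (k <_) (sym (rankOfLast-readTop fb s)) k<r)))
              (*-zeroʳ ⟦ allowed x fb s x ⟧)
    ... | inj₁ x<m rewrite read-low s x<m | allowed-low fb s x<m with fb x in fx
    ...   | true = refl
    ...   | false with allowedAfter s x in ok
    ...     | false = refl
    ...     | true rewrite tails-aboveRank L (low x) (x<m , fx) (<-≤-trans k<r (rankOfLast-≤ s x ok)) = refl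

  relabel : State → State
  relabel start    = start
  relabel (low c)  = low (rank fb c ∸ 1)
  relabel (high c) = high (rank fb c ∸ 1)

  relabel-readTop : ∀ s → relabel (readTop s) ≡ readTop (relabel s)
  relabel-readTop start    = refl
  relabel-readTop (low c)  = refl
  relabel-readTop (high c) = refl

  rankOfLast-relabel : ∀ s → Free s → rankOfLast (λ _ → false) (relabel s) ≡ rankOfLast fb s
  rankOfLast-relabel start    _        = refl
  rankOfLast-relabel (low c)  (_ , fc) rewrite ∑<-ones (suc (rank fb c ∸ 1)) | rank-free fb fc = refl
  rankOfLast-relabel (high c) (_ , fc) rewrite ∑<-ones (suc (rank fb c ∸ 1)) | rank-free fb fc = refl

  allowedAfter-relabel : ∀ s y → Free s → allowedAfter (relabel s) y ≡ allowedAfterRank s (suc y)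
  allowedAfter-relabel start    y _        = refl
  allowedAfter-relabel (low c)  y (_ , fc) rewrite rank-free fb fc = refl
  allowedAfter-relabel (high c) y (_ , fc) rewrite rank-free fb fc = refl

  tails-m tails-k : ℕ → State → ℕ
  tails-m = tails m fb (atRank fb k)
  tails-k = tails k (λ _ → false) (atRank (λ _ → false) k)

  tails-relabel : ∀ L s → Free s → rankOfLast fb s ≤ k → tails-m L s ≡ tails-k L (relabel s)
  tails-relabel zero    s v r≤k rewrite rankOfLast-relabel s v = refl
  tails-relabel (suc L) s v r≤k = begin
    ∑< A (suc m)     ≡⟨ ∑<-last A m ⟩
    ∑< A m + A m     ≡⟨ cong₂ _+_ lowLetters topLetter ⟩
    ∑< B k + B k     ≡⟨ ∑<-last B k ⟨
    ∑< B (suc k)     ∎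
    where
    A B F : ℕ → ℕ
    A x = ⟦ allowed m fb s x ⟧ * tails-m L (read m s x)
    B y = ⟦ allowed k (λ _ → false) (relabel s) y ⟧ * tails-k L (read k (relabel s) y)
    F j = ⟦ allowedAfterRank s (suc j) ⟧ * (⟦ j <ᵇ k ⟧ * tails-k L (low j))

    topLetter : A m ≡ B k
    topLetter rewrite ≡ᵇ-refl m | ≡ᵇ-refl k | sym (relabel-readTop s) =
      cong (_+ 0) (tails-relabel L (readTop s) (Free-readTop s v) (subst (_≤ k) (sym (rankOfLast-readTop fb s)) r≤k))

    lowLetter : ∀ x → x < m → A x ≡ ⟦ not (fb x) ⟧ * F (rank fb x ∸ 1)
    lowLetter x x<m rewrite read-low s x<m | allowed-low fb s x<m with fb x in fx
    ... | true  = refl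
    ... | false rewrite allowedAfter≡allowedAfterRank s x v fx | rank-free fb fx =
      trans (cong (⟦ allowedAfterRank s (suc j) ⟧ *_) next) (sym (+-identityʳ _))
      where
      j = rankBelow fb x
      next : tails-m L (low x) ≡ ⟦ j <ᵇ k ⟧ * tails-k L (low j)
      next with j <? k
      ... | yes j<k rewrite <⇒<ᵇ≡true j<k | tails-relabel L (low x) (x<m , fx) (subst (_≤ k) (sym (rank-free fb fx)) j<k) | rank-free fb fx =
        sym (+-identityʳ _)
      ... | no  j≮k rewrite ≥⇒<ᵇ≡false (≮⇒≥ j≮k) =
        tails-aboveRank L (low x) (x<m , fx) (subst (k <_) (sym (rank-free fb fx)) (s≤s (≮⇒≥ j≮k)))

    lowLetters : ∑< A m ≡ ∑< B k
    lowLetters = begin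
      ∑< A m                                          ≡⟨ ∑<-cong m lowLetter ⟩
      ∑< (λ x → ⟦ not (fb x) ⟧ * F (rank fb x ∸ 1)) m ≡⟨ ∑<-free fb F m ⟩
      ∑< F (rankBelow fb m)                           ≡⟨ ∑<-shrink F k≤free beyond-k ⟩
      ∑< F k                                          ≡⟨ ∑<-cong k (λ y y<k → sym (relabelled y y<k)) ⟩
      ∑< B k                                          ∎
      where
      beyond-k : ∀ j → k ≤ j → j < rankBelow fb m → F j ≡ 0
      beyond-k j k≤j _ rewrite ≥⇒<ᵇ≡false k≤j = *-zeroʳ ⟦ allowedAfterRank s (suc j) ⟧
      relabelled : ∀ y → y < k → B y ≡ F y
      relabelled y y<k rewrite read-low (relabel s) y<k | allowed-low (λ _ → false) (relabel s) y<k
                             | allowedAfter-relabel s y v | <⇒<ᵇ≡true y<k =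
        cong (⟦ allowedAfterRank s (suc y) ⟧ *_) (sym (+-identityʳ _))

-- The numbers 𝔟

all-not : ∀ (p : ℕ → Bool) xs → all (not ∘ p) xs ≡ not (any p xs)
all-not p []       = refl
all-not p (x ∷ xs) rewrite all-not p xs = sym (not-∨ (p x) (any p xs))

any-mono : ∀ (f g : ℕ → Bool) xs → (∀ x → f x ≡ true → g x ≡ true) → any f xs ≡ true → any g xs ≡ true
any-mono f g (x ∷ xs) f⇒g e with ∨-true⁻ {f x} e
... | inj₁ fx = ∨-trueˡ (f⇒g x fx)
... | inj₂ e′ = ∨-trueʳ {g x} (any-mono f g xs f⇒g e′)

containsTripleFrom-top : ∀ k w → All (_≤ k) w → containsTripleFrom P-triple k w ≡ not (orderedBelow k w)
containsTripleFrom-top k []      _           = refl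
containsTripleFrom-top k (b ∷ s) (b≤k ∷ s≤k) = begin
  any (P-triple k b) s ∨ containsTripleFrom P-triple k s
    ≡⟨ cong₂ _∨_ (any-cong-All (P-triple k b) descent s≤k (λ y _ → triple-k-b y)) (containsTripleFrom-top k s s≤k) ⟩
  any descent s ∨ not (orderedBelow k s)                     ≡⟨ not-involutive _ ⟨
  not (not (any descent s ∨ not (orderedBelow k s)))         ≡⟨ cong not (not-∨ (any descent s) _) ⟩
  not (not (any descent s) ∧ not (not (orderedBelow k s)))   ≡⟨ cong not (cong₂ _∧_ (all-not descent s) (sym (not-involutive (orderedBelow k s)))) ⟨
  not (all (not ∘ descent) s ∧ orderedBelow k s)             ∎
  where
  descent : ℕ → Bool
  descent y = (y <ᵇ b) ∧ (b <ᵇ k)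
  triple-k-b : ∀ y → P-triple k b y ≡ descent y
  triple-k-b y rewrite ≥⇒<ᵇ≡false {k} {b} b≤k | ∧-zeroʳ (k ≡ᵇ y) = ∧-comm (b <ᵇ k) (y <ᵇ b)

-- an occurrence a b c of 210 with a ≤ k gives the occurrence k b c
containsTriple210⇒containsTripleFrom-top : ∀ k w → All (_≤ k) w → containsTriple triple210 w ≡ true →
  containsTripleFrom P-triple k w ≡ true
containsTriple210⇒containsTripleFrom-top k (a ∷ s) (a≤k ∷ s≤k) e with ∨-true⁻ {containsTripleFrom triple210 a s} e
... | inj₁ from-a = ∨-trueʳ {any (P-triple k a) s} (from-a⇒from-k s from-a)
  where
  from-a⇒from-k : ∀ s → containsTripleFrom triple210 a s ≡ true → containsTripleFrom P-triple k s ≡ true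
  from-a⇒from-k (b ∷ s) e with ∨-true⁻ {any (triple210 a b) s} e
  ... | inj₂ e′ = ∨-trueʳ {any (P-triple k b) s} (from-a⇒from-k s e′)
  ... | inj₁ e′ = ∨-trueˡ (any-mono (triple210 a b) (P-triple k b) s abc⇒kbc e′)
    where
    abc⇒kbc : ∀ c → triple210 a b c ≡ true → P-triple k b c ≡ true
    abc⇒kbc c abc rewrite <⇒<ᵇ≡true (<-≤-trans (<ᵇ≡true⇒< {b} {a} (∧-trueˡ abc)) a≤k) = ∨-trueʳ {triple010 k b c} (∧-trueʳ abc)
... | inj₂ later = ∨-trueʳ {any (P-triple k a) s} (containsTriple210⇒containsTripleFrom-top k s s≤k later)

avoidsP-top-∷ : ∀ k w → All (_≤ k) w → not (containsP (k ∷ w)) ≡ avoidsAll (p010 ∷ []) w ∧ orderedBelow k w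
avoidsP-top-∷ k w w≤k
  rewrite contains-010 w | containsTriple-∨ triple010 triple210 w
        | sym (not-involutive (orderedBelow k w)) | sym (containsTripleFrom-top k w w≤k)
  with containsTripleFrom P-triple k w in from-k
... | true = sym (∧-zeroʳ _)
... | false with containsTriple triple210 w in has210
...   | true  = ⊥-elim (not-¬ (containsTriple210⇒containsTripleFrom-top k w w≤k has210) from-k)
...   | false = sym (∧-identityʳ _)

tailsB : ℕ → ℕ → ℕ
tailsB L k = tails k (λ _ → false) (atRank (λ _ → false) k) L start

tailsB-0 : ∀ L → tailsB L 0 ≡ 1
tailsB-0 zero    = refl
tailsB-0 (suc L) rewrite tailsB-0 L = refl

suc≡ᵇ : ∀ n → (suc n ≡ᵇ n) ≡ false
suc≡ᵇ n = ≢⇒≡ᵇ≡false (1+n≢n {n})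

-- 𝔟 is the tail count for α empty: every value is free, so the last low letter c has rank c + 1.
module _ (k′ : ℕ) where
  private
    k = suc k′
  open Tail [] k []

  endsWithRank-k : ∀ {β s} → Tracks β s → All (_≤ k) β → containsP (σ β) ≡ false → ⟦ k′ ∈ᵇ β ⟧ ≡ atRank (λ _ → false) k s
  endsWithRank-k {β} {s} I _ _ = cong ⟦_⟧ (true-ext to from)
    where
    to : k′ ∈ᵇ β ≡ true → (rankOfLast (λ _ → false) s ≡ᵇ k) ≡ true
    to k′∈β = by-state s (∈-σ I k′ ≤-refl (∨-trueʳ {k ≡ᵇ k′} k′∈β)) (last∈σ I)
      where
      by-state : ∀ s′ → upToLast s′ k′ ≡ true → (∀ c → LastLow s′ c → c ∈ᵇ σ β ≡ true × c < k) →
                 (rankOfLast (λ _ → false) s′ ≡ᵇ k) ≡ true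
      by-state (low c)  k′≤c last
        rewrite ∑<-ones c | ≤-antisym (≤-pred (proj₂ (last c refl))) (≤-pred (<ᵇ≡true⇒< {k′} {suc c} k′≤c)) = ≡ᵇ-refl k′
      by-state (high c) k′≤c last
        rewrite ∑<-ones c | ≤-antisym (≤-pred (proj₂ (last c refl))) (≤-pred (<ᵇ≡true⇒< {k′} {suc c} k′≤c)) = ≡ᵇ-refl k′
    from : (rankOfLast (λ _ → false) s ≡ᵇ k) ≡ true → k′ ∈ᵇ β ≡ true
    from e = by-state s e (last∈σ I)
      where
      last-is-k′ : ∀ c → c ≡ k′ → c ∈ᵇ σ β ≡ true → k′ ∈ᵇ β ≡ true
      last-is-k′ c refl c∈σ rewrite suc≡ᵇ c = c∈σ
      by-state : ∀ s′ → (rankOfLast (λ _ → false) s′ ≡ᵇ k) ≡ true → (∀ c → LastLow s′ c → c ∈ᵇ σ β ≡ true × c < k) →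
                 k′ ∈ᵇ β ≡ true
      by-state (low c)  e last rewrite ∑<-ones c = last-is-k′ c (≡ᵇ≡true⇒≡ {c} {k′} e) (proj₁ (last c refl))
      by-state (high c) e last rewrite ∑<-ones c = last-is-k′ c (≡ᵇ≡true⇒≡ {c} {k′} e) (proj₁ (last c refl))

  𝔟-suc≡tailsB : ∀ L → 𝔟 L k ≡ tailsB L k
  𝔟-suc≡tailsB L = begin
    𝔟 L k                                        ≡⟨ countB≡sum _ (words k L) ⟩
    sum (map (⟦_⟧ ∘ counted) (words k L))        ≡⟨ sum-map-words k L _ ⟩
    ∑W k L (⟦_⟧ ∘ counted)                       ≡⟨ ∑W-cong k L (λ w w≤k _ → counted≡validTail w w≤k) ⟩
    ∑W k L (λ γ → validTail (k′ ∈ᵇ_) ([] ++ γ))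
      ≡⟨ ∑W-validTail k ≤-refl (k′ ∈ᵇ_) (atRank (λ _ → false) k) endsWithRank-k L tracks-[] [] refl ⟩
    tailsB L k                                   ∎
    where
    counted : List ℕ → Bool
    counted ω = avoidsAll (p010 ∷ []) ω ∧ orderedBelow k ω ∧ k′ ∈ᵇ ω
    counted≡validTail : ∀ w → All (_≤ k) w → ⟦ counted w ⟧ ≡ validTail (k′ ∈ᵇ_) w
    counted≡validTail w w≤k rewrite all≤ᵇ-true k w≤k | avoidsP-top-∷ k w w≤k =
      cong ⟦_⟧ (sym (∧-assoc (avoidsAll (p010 ∷ []) w) (orderedBelow k w) (k′ ∈ᵇ w)))

𝔟≡tailsB : ∀ L k → 𝔟 L k ≡ tailsB L k
𝔟≡tailsB L zero     = sym (tailsB-0 L)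
𝔟≡tailsB L (suc k′) = 𝔟-suc≡tailsB k′ L

forbCount-prefix : ∀ α m → All (_< m) α → containsP α ≡ false → forbCount P α ≡ ∑< (⟦_⟧ ∘ forbᵇ α) m
forbCount-prefix []       m _   _        = sym (∑<-≡0 m (λ _ _ → refl))
forbCount-prefix (a ∷ α′) m α<m α-avoids = begin
  forbCount P (a ∷ α′)             ≡⟨ forbCount-P (a ∷ α′) M (≤-maxℕ a α′) (maxℕ-∈ a α′) α-avoids ⟩
  ∑< (⟦_⟧ ∘ forbᵇ (a ∷ α′)) (suc M) ≡⟨ ∑<-shrink _ (All-maxℕ a α′ α<m) beyond-max ⟨
  ∑< (⟦_⟧ ∘ forbᵇ (a ∷ α′)) m       ∎
  where
  M = maxℕ (a ∷ α′)
  beyond-max : ∀ v → suc M ≤ v → v < m → ⟦ forbᵇ (a ∷ α′) v ⟧ ≡ 0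
  beyond-max v M<v _ rewrite completesP-≥ (a ∷ α′) (All.map (λ x≤M → ≤-trans x≤M (<⇒≤ M<v)) (≤-maxℕ a α′))
                           | ∈ᵇ-∉ v (a ∷ α′) (All.map (λ x≤M → <⇒≢ (≤-<-trans x≤M M<v)) (≤-maxℕ a α′)) = refl

+1≡ᵇ : ∀ {i f} r → i < f → ((i + r) + 1 ≡ᵇ f) ≡ (r ≡ᵇ f ∸ i ∸ 1)
+1≡ᵇ {i} {f} r i<f = true-ext (λ e → ≡⇒≡ᵇ≡true (to (≡ᵇ≡true⇒≡ e))) (λ e → ≡⇒≡ᵇ≡true (from (≡ᵇ≡true⇒≡ e)))
  where
  to : (i + r) + 1 ≡ f → r ≡ f ∸ i ∸ 1
  to refl = sym (begin
    (i + r) + 1 ∸ i ∸ 1     ≡⟨ cong (_∸ 1) (cong (_∸ i) (+-assoc i r 1)) ⟩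
    i + (r + 1) ∸ i ∸ 1     ≡⟨ cong (_∸ 1) (m+n∸m≡n i (r + 1)) ⟩
    r + 1 ∸ 1               ≡⟨ m+n∸n≡m r 1 ⟩
    r                       ∎)
  from : r ≡ f ∸ i ∸ 1 → (i + r) + 1 ≡ f
  from refl = begin
    (i + (f ∸ i ∸ 1)) + 1   ≡⟨ +-comm (i + (f ∸ i ∸ 1)) 1 ⟩
    suc i + (f ∸ i ∸ 1)     ≡⟨ cong (suc i +_) (∸-+-assoc f i 1) ⟩
    suc i + (f ∸ (i + 1))   ≡⟨ cong (λ z → suc i + (f ∸ z)) (+-comm i 1) ⟩
    suc i + (f ∸ suc i)     ≡⟨ m+[n∸m]≡n i<f ⟩
    f                       ∎

+1≢ᵇ : ∀ {i f} r → f ≤ i → ((i + r) + 1 ≡ᵇ f) ≡ false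
+1≢ᵇ {i} {f} r f≤i = ≢⇒≡ᵇ≡false (λ e → <⇒≱ (≤-<-trans (m≤m+n i r) (subst (i + r <_) e (m<m+n (i + r) z<s))) f≤i)

module _ (n m f : ℕ) (m≤n : m ≤ n) (f≤m+1 : f ≤ m + 1) (α : List ℕ) (α<m : All (_< m) α) (α-avoids : containsP α ≡ false) where

  open Tail α m α<m

  private
    i₀ = ∑< (⟦_⟧ ∘ forbᵇ α) m

    forbCountIs-f : State → ℕ
    forbCountIs-f s = ⟦ (i₀ + rankOfLast (forbᵇ α) s) + 1 ≡ᵇ f ⟧

    forbCountIs-f-correct : ∀ {β s} → Tracks β s → All (_≤ m) β → containsP (σ β) ≡ false →
                            ⟦ forbCount P (σ β) ≡ᵇ f ⟧ ≡ forbCountIs-f s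
    forbCountIs-f-correct I β≤m σ-avoids rewrite forbCount-σ I β≤m σ-avoids = refl

    start-avoids : containsP (σ []) ≡ false
    start-avoids rewrite containsTriple-snoc P-triple α m | α-avoids = completesP-≥ α (All.map <⇒≤ α<m)

    i₀+free≡m : i₀ + rankBelow (forbᵇ α) m ≡ m
    i₀+free≡m = ∑<-complement (forbᵇ α) m

    k≤free : f ∸ i₀ ∸ 1 ≤ rankBelow (forbᵇ α) m
    k≤free = ≤-trans (∸-monoˡ-≤ 1 (∸-monoˡ-≤ i₀ f≤m+1)) (≤-reflexive (begin
      m + 1 ∸ i₀ ∸ 1                            ≡⟨ cong (λ z → z ∸ i₀ ∸ 1) (+-comm m 1) ⟩
      suc m ∸ i₀ ∸ 1                            ≡⟨ cong (λ z → suc z ∸ i₀ ∸ 1) i₀+free≡m ⟨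
      suc (i₀ + rankBelow (forbᵇ α) m) ∸ i₀ ∸ 1 ≡⟨ cong (_∸ 1) (+-∸-assoc 1 (m≤m+n i₀ _)) ⟩
      suc (i₀ + rankBelow (forbᵇ α) m ∸ i₀) ∸ 1 ≡⟨ m+n∸m≡n i₀ _ ⟩
      rankBelow (forbᵇ α) m                     ∎))

  ∑W-tailsWithForbCount : ∀ L → ∑W n L (validTail (λ ω → forbCount P (σ ω) ≡ᵇ f)) ≡
                                ⟦ forbCount P α <ᵇ f ⟧ * 𝔟 L (f ∸ forbCount P α ∸ 1)
  ∑W-tailsWithForbCount L rewrite forbCount-prefix α m α<m α-avoids = begin
    ∑W n L (λ ω → validTail Ψ ([] ++ ω))
      ≡⟨ ∑W-validTail n m≤n Ψ forbCountIs-f forbCountIs-f-correct L tracks-[] [] start-avoids ⟩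
    tails m (forbᵇ α) forbCountIs-f L start
      ≡⟨ by-cases ⟩
    ⟦ i₀ <ᵇ f ⟧ * 𝔟 L (f ∸ i₀ ∸ 1) ∎
    where
    Ψ = λ ω → forbCount P (σ ω) ≡ᵇ f
    by-cases : tails m (forbᵇ α) forbCountIs-f L start ≡ ⟦ i₀ <ᵇ f ⟧ * 𝔟 L (f ∸ i₀ ∸ 1)
    by-cases with i₀ <? f
    ... | no  i₀≮f rewrite ≥⇒<ᵇ≡false (≮⇒≥ i₀≮f) =
      tails-≡0 m (forbᵇ α) L start (λ s → cong ⟦_⟧ (+1≢ᵇ (rankOfLast (forbᵇ α) s) (≮⇒≥ i₀≮f)))
    ... | yes i₀<f rewrite <⇒<ᵇ≡true i₀<f = begin
      tails m (forbᵇ α) forbCountIs-f L start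
        ≡⟨ tails-cong m (forbᵇ α) L start (λ s → cong ⟦_⟧ (+1≡ᵇ (rankOfLast (forbᵇ α) s) i₀<f)) ⟩
      Relabel.tails-m m (forbᵇ α) k k≤free L start
        ≡⟨ Relabel.tails-relabel m (forbᵇ α) k k≤free L start _ z≤n ⟩
      tailsB L k
        ≡⟨ 𝔟≡tailsB L k ⟨
      𝔟 L k
        ≡⟨ *-identityˡ (𝔟 L k) ⟨
      1 * 𝔟 L k ∎
      where k = f ∸ i₀ ∸ 1

-- The recurrence

countedBy𝔞 : ℕ → ℕ → List ℕ → Bool
countedBy𝔞 m f σ = isInvSeq σ ∧ (avoidsAll P σ ∧ (maxIs σ m ∧ (forbCount P σ ≡ᵇ f)))

-- Any alphabet {0, …, N} with N ≥ n contains the letters of the inversion sequences of size n.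
𝔞≡∑W : ∀ N n m f → n ≤ N → 𝔞 n m f ≡ ∑W N n (⟦_⟧ ∘ countedBy𝔞 m f)
𝔞≡∑W N n m f n≤N = begin
  𝔞 n m f                                        ≡⟨ countB-filter isInvSeq properties (words n n) ⟩
  sum (map (⟦_⟧ ∘ countedBy𝔞 m f) (words n n))   ≡⟨ sum-map-words n n _ ⟩
  ∑W n n (⟦_⟧ ∘ countedBy𝔞 m f)                  ≡⟨ ∑W-cong n n (λ σ _ _ → ⟦∧⟧ (isInvSeq σ) _) ⟩
  ∑W n n (λ σ → ⟦ isInvFrom 1 σ ⟧ * ⟦ properties σ ⟧) ≡⟨ ∑W-isInvFrom n 1 n _ ≤-refl ⟩
  ∑Inv 1 n (⟦_⟧ ∘ properties)                    ≡⟨ ∑W-isInvFrom N 1 n _ (s≤s n≤N) ⟨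
  ∑W N n (λ σ → ⟦ isInvFrom 1 σ ⟧ * ⟦ properties σ ⟧) ≡⟨ ∑W-cong N n (λ σ _ _ → ⟦∧⟧ (isInvSeq σ) _) ⟨
  ∑W N n (⟦_⟧ ∘ countedBy𝔞 m f)                  ∎
  where
  properties : List ℕ → Bool
  properties σ = avoidsAll P σ ∧ (maxIs σ m ∧ (forbCount P σ ≡ᵇ f))

isInvFrom-++ : ∀ i xs ys → isInvFrom i (xs ++ ys) ≡ isInvFrom i xs ∧ isInvFrom (i + length xs) ys
isInvFrom-++ i []       ys rewrite +-identityʳ i = refl
isInvFrom-++ i (x ∷ xs) ys rewrite isInvFrom-++ (suc i) xs ys | +-suc i (length xs) = sym (∧-assoc (x <ᵇ i) _ _)

isInvFrom-< : ∀ j {w} → All (_< j) w → isInvFrom j w ≡ true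
isInvFrom-< j []         = refl
isInvFrom-< j (x<j ∷ w<j) rewrite <⇒<ᵇ≡true x<j = isInvFrom-< (suc j) (All.map m≤n⇒m≤1+n w<j)

∧-rearrange : ∀ a b c d e g h → (a ∧ (b ∧ d)) ∧ (e ∧ ((c ∧ g) ∧ h)) ≡ (a ∧ (b ∧ c)) ∧ (d ∧ (e ∧ (g ∧ h)))
∧-rearrange false _     _     _     _     _ _ = refl
∧-rearrange true  false _     _     _     _ _ = refl
∧-rearrange true  true  true  _     _     _ _ = refl
∧-rearrange true  true  false false _     _ _ = refl
∧-rearrange true  true  false true  false _ _ = refl
∧-rearrange true  true  false true  true  _ _ = refl

∧-false-middle : ∀ a b → a ∧ (false ∧ b) ≡ false
∧-false-middle true  b = refl
∧-false-middle false b = refl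

∧-absorb : ∀ a b c d → a ∧ (b ∧ (c ∧ d)) ≡ b ∧ (c ∧ (a ∧ d))
∧-absorb true  b     c     d = refl
∧-absorb false false c     d = refl
∧-absorb false true  false d = refl
∧-absorb false true  true  d = refl

⟦⟧-pull : ∀ a b c d e → ⟦ a ∧ (b ∧ ((c ∧ d) ∧ e)) ⟧ ≡ ⟦ c ⟧ * ⟦ a ∧ (b ∧ (d ∧ e)) ⟧
⟦⟧-pull a     b     true  d e = sym (+-identityʳ _)
⟦⟧-pull true  true  false d e = refl
⟦⟧-pull true  false false d e = refl
⟦⟧-pull false b     false d e = refl

module Recurrence (n m f : ℕ) (2≤f : 2 ≤ f) (f≤m+1 : f ≤ m + 1) (m+1≤n : m + 1 ≤ n) where

  1≤m : 1 ≤ m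
  1≤m = ≤-pred (≤-trans 2≤f (subst (f ≤_) (+-comm m 1) f≤m+1))

  m≤n : m ≤ n
  m≤n = ≤-trans (m≤m+n m 1) m+1≤n

  counted≤ : List ℕ → Bool
  counted≤ σ = isInvSeq σ ∧ (avoidsAll P σ ∧ (all≤ᵇ m σ ∧ (forbCount P σ ≡ᵇ f)))

  -- the contribution of the prefixes α of length q preceding the first occurrence of m
  prefixTerm : ℕ → List ℕ → ℕ
  prefixTerm q α = ⟦ isInvSeq α ∧ ((m <ᵇ suc q) ∧ all<ᵇ m α) ⟧ *
                   (⟦ avoidsAll P α ⟧ * (⟦ forbCount P α <ᵇ f ⟧ * 𝔟 (n ∸ suc q) (f ∸ forbCount P α ∸ 1)))

  𝔞-byFirstMax : 𝔞 n m f ≡ ∑< (λ q → ∑W n q (λ α → ⟦ m ∉ᵇ α ⟧ * ∑W n (n ∸ suc q) (λ ω → ⟦ counted≤ (α ++ m ∷ ω) ⟧))) n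
  𝔞-byFirstMax = begin
    𝔞 n m f                                  ≡⟨ 𝔞≡∑W n n m f ≤-refl ⟩
    ∑W n n (⟦_⟧ ∘ countedBy𝔞 m f)            ≡⟨ ∑W-cong n n (λ σ _ _ → split σ) ⟩
    ∑W n n (λ σ → ⟦ m ∈ᵇ σ ⟧ * ⟦ counted≤ σ ⟧) ≡⟨ ∑W-firstOccurrence n m n (⟦_⟧ ∘ counted≤) m≤n ⟩
    _                                        ∎
    where
    split : ∀ σ → ⟦ countedBy𝔞 m f σ ⟧ ≡ ⟦ m ∈ᵇ σ ⟧ * ⟦ counted≤ σ ⟧
    split σ rewrite maxIs≡∈ᵇ∧all≤ᵇ σ m = ⟦⟧-pull (isInvSeq σ) (avoidsAll P σ) (m ∈ᵇ σ) (all≤ᵇ m σ) (forbCount P σ ≡ᵇ f)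

  tailOK : List ℕ → List ℕ → Bool
  tailOK α ω = not (containsP (α ++ m ∷ ω)) ∧ (all≤ᵇ m ω ∧ (forbCount P (α ++ m ∷ ω) ≡ᵇ f))

  counted≤-++ : ∀ α ω → counted≤ (α ++ m ∷ ω) ≡
    (isInvSeq α ∧ ((m <ᵇ suc (length α)) ∧ all≤ᵇ m α)) ∧ (isInvFrom (suc (suc (length α))) ω ∧ tailOK α ω)
  counted≤-++ α ω rewrite isInvFrom-++ 1 α (m ∷ ω) | containsSome-P (α ++ m ∷ ω) | all-++ (_<ᵇ suc m) α (m ∷ ω)
                        | <⇒<ᵇ≡true (≤-refl {suc m}) =
    ∧-rearrange (isInvSeq α) (m <ᵇ suc (length α)) (all≤ᵇ m α) (isInvFrom (suc (suc (length α))) ω)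
                (not (containsP (α ++ m ∷ ω))) (all≤ᵇ m ω) (forbCount P (α ++ m ∷ ω) ≡ᵇ f)

  ∑W-tailOK : ∀ q α → length α ≡ q → m ≤ q → All (_< m) α →
    ∑W n (n ∸ suc q) (λ ω → ⟦ isInvFrom (suc (suc q)) ω ∧ tailOK α ω ⟧) ≡
    ⟦ avoidsAll P α ⟧ * (⟦ forbCount P α <ᵇ f ⟧ * 𝔟 (n ∸ suc q) (f ∸ forbCount P α ∸ 1))
  ∑W-tailOK q α refl m≤q α<m rewrite containsSome-P α with containsP α in α-contains
  ... | true  = ∑W-≡0 n (n ∸ suc q) (λ ω _ _ → dead ω)
    where
    dead : ∀ ω → ⟦ isInvFrom (suc (suc q)) ω ∧ tailOK α ω ⟧ ≡ 0
    dead ω rewrite containsTriple-++ P-triple α (m ∷ ω) α-contains =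
      cong ⟦_⟧ (∧-false-middle (isInvFrom (suc (suc q)) ω) (all≤ᵇ m ω ∧ (forbCount P (α ++ m ∷ ω) ≡ᵇ f)))
  ... | false = begin
    ∑W n L (λ ω → ⟦ isInvFrom (suc (suc q)) ω ∧ tailOK α ω ⟧)
      ≡⟨ ∑W-cong n L (λ ω _ _ → inversionFree ω) ⟩
    ∑W n L (λ ω → ⟦ tailOK α ω ⟧)
      ≡⟨ ∑W-tailsWithForbCount n m f m≤n f≤m+1 α α<m α-contains L ⟩
    ⟦ forbCount P α <ᵇ f ⟧ * 𝔟 L (f ∸ forbCount P α ∸ 1)
      ≡⟨ +-identityʳ _ ⟨
    1 * (⟦ forbCount P α <ᵇ f ⟧ * 𝔟 L (f ∸ forbCount P α ∸ 1)) ∎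
    where
    L = n ∸ suc q
    -- a tail ω ≤ m ≤ q satisfies the inversion-sequence condition automatically
    inversionFree : ∀ ω → ⟦ isInvFrom (suc (suc q)) ω ∧ tailOK α ω ⟧ ≡ ⟦ tailOK α ω ⟧
    inversionFree ω with all≤ᵇ m ω in ω≤m
    ... | true  rewrite isInvFrom-< (suc (suc q)) (All.map (λ x≤m → s≤s (≤-trans x≤m (≤-trans m≤q (n≤1+n q)))) (all≤ᵇ⇒All m ω ω≤m)) = refl
    ... | false = cong ⟦_⟧ (trans (cong (isInvFrom (suc (suc q)) ω ∧_) (∧-false-middle E H)) (trans (∧-zeroʳ _) (sym (∧-false-middle E H))))
      where
      E = not (containsP (α ++ m ∷ ω))
      H = forbCount P (α ++ m ∷ ω) ≡ᵇ f

  firstMaxAt : ∀ q α → length α ≡ q →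
    ⟦ m ∉ᵇ α ⟧ * ∑W n (n ∸ suc q) (λ ω → ⟦ counted≤ (α ++ m ∷ ω) ⟧) ≡ prefixTerm q α
  firstMaxAt q α refl = begin
    ⟦ m ∉ᵇ α ⟧ * ∑W n L (λ ω → ⟦ counted≤ (α ++ m ∷ ω) ⟧)
      ≡⟨ cong (⟦ m ∉ᵇ α ⟧ *_) (trans (∑W-cong n L (λ ω _ _ → trans (cong ⟦_⟧ (counted≤-++ α ω)) (⟦∧⟧ pre _)))
                                    (∑W-*ˡ n L ⟦ pre ⟧ post)) ⟩
    ⟦ m ∉ᵇ α ⟧ * (⟦ pre ⟧ * ∑W n L post)
      ≡⟨ *-assoc ⟦ m ∉ᵇ α ⟧ ⟦ pre ⟧ _ ⟨
    (⟦ m ∉ᵇ α ⟧ * ⟦ pre ⟧) * ∑W n L post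
      ≡⟨ cong (_* ∑W n L post) (trans (sym (⟦∧⟧ (m ∉ᵇ α) pre)) (cong ⟦_⟧ absorb)) ⟩
    ⟦ prefixOK ⟧ * ∑W n L post
      ≡⟨ tails-ifPrefixOK ⟩
    prefixTerm q α ∎
    where
    L = n ∸ suc q
    pre prefixOK : Bool
    pre = isInvSeq α ∧ ((m <ᵇ suc q) ∧ all≤ᵇ m α)
    prefixOK = isInvSeq α ∧ ((m <ᵇ suc q) ∧ all<ᵇ m α)
    post : List ℕ → ℕ
    post ω = ⟦ isInvFrom (suc (suc q)) ω ∧ tailOK α ω ⟧
    absorb : m ∉ᵇ α ∧ pre ≡ prefixOK
    absorb = trans (∧-absorb (m ∉ᵇ α) (isInvSeq α) (m <ᵇ suc q) (all≤ᵇ m α))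
                   (cong (λ b → isInvSeq α ∧ ((m <ᵇ suc q) ∧ b)) (∉ᵇ∧all≤ᵇ m α))
    tails-ifPrefixOK : ⟦ prefixOK ⟧ * ∑W n L post ≡ prefixTerm q α
    tails-ifPrefixOK with prefixOK in ok
    ... | false = refl
    ... | true  = cong (1 *_) (∑W-tailOK q α refl m≤q α<m)
      where
      m≤q = ≤-pred (<ᵇ≡true⇒< (∧-trueˡ {m <ᵇ suc q} (∧-trueʳ {isInvSeq α} ok)))
      α<m = all<ᵇ⇒All m α (∧-trueʳ {m <ᵇ suc q} (∧-trueʳ {isInvSeq α} ok))

  -- in an inversion sequence, m cannot occur at a position p ≤ m
  prefixTerm-early : ∀ q α → q < m → prefixTerm q α ≡ 0
  prefixTerm-early q α q<m rewrite ≥⇒<ᵇ≡false {m} {suc q} q<m | ∧-false-middle (isInvSeq α) (all<ᵇ m α) = refl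

  -- sorting the prefix α by its maximum j < m and its number i of forbidden values
  prefixTerm-regroup : ∀ q α → m ≤ q → length α ≡ q →
    prefixTerm q α ≡ ∑< (λ i → 𝔟 (n ∸ suc q) (f ∸ i ∸ 1) * ∑< (λ j → ⟦ countedBy𝔞 j i α ⟧) m) f
  prefixTerm-regroup q []       m≤q refl = ⊥-elim (<⇒≱ 1≤m m≤q)
  prefixTerm-regroup q (y ∷ ys) m≤q _    = sym (begin
    ∑< (λ i → 𝔟 L (f ∸ i ∸ 1) * ∑< (λ j → ⟦ countedBy𝔞 j i α ⟧) m) f
      ≡⟨ ∑<-cong f (λ i _ → cong (𝔟 L (f ∸ i ∸ 1) *_) (trans (∑<-cong m (λ j _ → split j i)) (∑<-pick _ M m))) ⟩
    ∑< (λ i → 𝔟 L (f ∸ i ∸ 1) * (⟦ M <ᵇ m ⟧ * (⟦ i ≡ᵇ fc ⟧ * (⟦ I ⟧ * ⟦ A ⟧)))) f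
      ≡⟨ ∑<-cong f (λ i _ → reorder (𝔟 L (f ∸ i ∸ 1)) ⟦ M <ᵇ m ⟧ ⟦ i ≡ᵇ fc ⟧ ⟦ I ⟧ ⟦ A ⟧) ⟩
    ∑< (λ i → ⟦ i ≡ᵇ fc ⟧ * (𝔟 L (f ∸ i ∸ 1) * (⟦ M <ᵇ m ⟧ * (⟦ I ⟧ * ⟦ A ⟧)))) f
      ≡⟨ ∑<-pick (λ i → 𝔟 L (f ∸ i ∸ 1) * (⟦ M <ᵇ m ⟧ * (⟦ I ⟧ * ⟦ A ⟧))) fc f ⟩
    ⟦ fc <ᵇ f ⟧ * (𝔟 L (f ∸ fc ∸ 1) * (⟦ M <ᵇ m ⟧ * (⟦ I ⟧ * ⟦ A ⟧)))
      ≡⟨ reorder′ ⟦ fc <ᵇ f ⟧ (𝔟 L (f ∸ fc ∸ 1)) ⟦ M <ᵇ m ⟧ ⟦ I ⟧ ⟦ A ⟧ ⟩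
    ⟦ I ⟧ * ⟦ M <ᵇ m ⟧ * (⟦ A ⟧ * (⟦ fc <ᵇ f ⟧ * 𝔟 L (f ∸ fc ∸ 1)))
      ≡⟨ cong (_* (⟦ A ⟧ * (⟦ fc <ᵇ f ⟧ * 𝔟 L (f ∸ fc ∸ 1)))) prefixBits ⟩
    prefixTerm q α ∎)
    where
    α = y ∷ ys
    L = n ∸ suc q
    M = maxℕ α
    fc = forbCount P α
    I = isInvSeq α
    A = avoidsAll P α
    reorder₀ : ∀ a b c d → a * (b * (c * d)) ≡ c * (d * (a * b))
    reorder₀ = solve-∀
    prefixBits : ⟦ I ⟧ * ⟦ M <ᵇ m ⟧ ≡ ⟦ I ∧ ((m <ᵇ suc q) ∧ all<ᵇ m α) ⟧
    prefixBits rewrite <⇒<ᵇ≡true (s≤s m≤q) | all<ᵇ≡maxℕ<ᵇ m y ys = sym (⟦∧⟧ I (M <ᵇ m))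
    split : ∀ j i → ⟦ countedBy𝔞 j i α ⟧ ≡ ⟦ j ≡ᵇ M ⟧ * (⟦ i ≡ᵇ fc ⟧ * (⟦ I ⟧ * ⟦ A ⟧))
    split j i rewrite ⟦∧⟧ I (A ∧ ((M ≡ᵇ j) ∧ (fc ≡ᵇ i))) | ⟦∧⟧ A ((M ≡ᵇ j) ∧ (fc ≡ᵇ i)) | ⟦∧⟧ (M ≡ᵇ j) (fc ≡ᵇ i)
                  | ≡ᵇ-sym M j | ≡ᵇ-sym fc i = reorder₀ ⟦ I ⟧ ⟦ A ⟧ ⟦ j ≡ᵇ M ⟧ ⟦ i ≡ᵇ fc ⟧
    reorder : ∀ b x y c d → b * (x * (y * (c * d))) ≡ y * (b * (x * (c * d)))
    reorder = solve-∀
    reorder′ : ∀ x b y c d → x * (b * (y * (c * d))) ≡ c * y * (d * (x * b))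
    reorder′ = solve-∀

  summand : ℕ → ℕ
  summand p = sumFromTo 0 (f ∸ 1) (λ i → 𝔟 (n ∸ p) (f ∸ i ∸ 1) * sumFromTo 0 (m ∸ 1) (λ j → 𝔞 (p ∸ 1) j i))

  ∑W-prefixTerm : ∀ q → m ≤ q → q < n → ∑W n q (prefixTerm q) ≡ summand (suc q)
  ∑W-prefixTerm q m≤q q<n = sym (begin
    summand (suc q)
      ≡⟨ sumFromTo-from0 f _ (≤-trans (s≤s z≤n) 2≤f) ⟩
    ∑< (λ i → 𝔟 L (f ∸ i ∸ 1) * sumFromTo 0 (m ∸ 1) (λ j → 𝔞 q j i)) f
      ≡⟨ ∑<-cong f (λ i _ → cong (𝔟 L (f ∸ i ∸ 1) *_)
                                 (trans (sumFromTo-from0 m _ 1≤m) (∑<-cong m (λ j _ → 𝔞≡∑W n q j i (<⇒≤ q<n))))) ⟩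
    ∑< (λ i → 𝔟 L (f ∸ i ∸ 1) * ∑< (λ j → ∑W n q (⟦_⟧ ∘ countedBy𝔞 j i)) m) f
      ≡⟨ ∑<-cong f (λ i _ → trans (∑W-*ˡ n q (𝔟 L (f ∸ i ∸ 1)) (λ α → ∑< (λ j → ⟦ countedBy𝔞 j i α ⟧) m))
                                  (cong (𝔟 L (f ∸ i ∸ 1) *_) (∑W-∑< n q (λ j α → ⟦ countedBy𝔞 j i α ⟧) m))) ⟨
    ∑< (λ i → ∑W n q (λ α → 𝔟 L (f ∸ i ∸ 1) * ∑< (λ j → ⟦ countedBy𝔞 j i α ⟧) m)) f
      ≡⟨ ∑W-∑< n q (λ i α → 𝔟 L (f ∸ i ∸ 1) * ∑< (λ j → ⟦ countedBy𝔞 j i α ⟧) m) f ⟨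
    ∑W n q (λ α → ∑< (λ i → 𝔟 L (f ∸ i ∸ 1) * ∑< (λ j → ⟦ countedBy𝔞 j i α ⟧) m) f)
      ≡⟨ ∑W-cong n q (λ α _ |α| → prefixTerm-regroup q α m≤q |α|) ⟨
    ∑W n q (prefixTerm q) ∎)
    where L = n ∸ suc q

theorem20 : (n m f : ℕ) → 2 ≤ f → f ≤ m + 1 → m + 1 ≤ n →
  𝔞 n m f ≡ sumFromTo (m + 1) n (λ p → sumFromTo 0 (f ∸ 1) (λ i →
    𝔟 (n ∸ p) (f ∸ i ∸ 1) * sumFromTo 0 (m ∸ 1) (λ j → 𝔞 (p ∸ 1) j i)))
theorem20 n m f 2≤f f≤m+1 m+1≤n = begin
  𝔞 n m f
    ≡⟨ 𝔞-byFirstMax ⟩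
  ∑< (λ q → ∑W n q (λ α → ⟦ m ∉ᵇ α ⟧ * ∑W n (n ∸ suc q) (λ ω → ⟦ counted≤ (α ++ m ∷ ω) ⟧))) n
    ≡⟨ ∑<-cong n (λ q _ → ∑W-cong n q (λ α _ |α| → firstMaxAt q α |α|)) ⟩
  ∑< prefixSum n
    ≡⟨ trans (cong (∑< prefixSum) (sym (m+[n∸m]≡n m≤n))) (∑<-split prefixSum m (n ∸ m)) ⟩
  ∑< prefixSum m + ∑< (λ t → prefixSum (m + t)) (n ∸ m)
    ≡⟨ cong (_+ ∑< (λ t → prefixSum (m + t)) (n ∸ m)) (∑<-≡0 m (λ q q<m → ∑W-≡0 n q (λ α _ _ → prefixTerm-early q α q<m))) ⟩
  ∑< (λ t → prefixSum (m + t)) (n ∸ m)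
    ≡⟨ ∑<-cong (n ∸ m) (λ t t<n∸m → ∑W-prefixTerm (m + t) (m≤m+n m t) (m+t<n t<n∸m)) ⟩
  ∑< (λ t → summand (suc (m + t))) (n ∸ m)
    ≡⟨ trans (cong (λ a → sumFromTo a n summand) (+-comm m 1)) (sumFromTo-suc m n summand) ⟨
  sumFromTo (m + 1) n summand ∎
  where
  open Recurrence n m f 2≤f f≤m+1 m+1≤n
  prefixSum : ℕ → ℕ
  prefixSum q = ∑W n q (prefixTerm q)
  m+t<n : ∀ {t} → t < n ∸ m → m + t < n
  m+t<n t<n∸m = subst (_ <_) (m+[n∸m]≡n m≤n) (+-monoʳ-< m t<n∸m)
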